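{- Fix positive integers $k<n$. Let $\alpha,\beta$ be cylindric partitions on $\mathcal{C}_{k,n}$ and $m$ a nonnegative integer. Let $M$ be the set of cylindric partitions $\mu$ with $\mu\subseteq\alpha$, $\mu\subseteq\beta$, and $\alpha/\mu$ containing exactly $m$ boxes. Let $\Lambda$ be the set of cylindric partitions $\lambda$ with $\alpha\subseteq\lambda$, $\beta\subseteq\lambda$, and $\lambda/\beta$ containing exactly $m$ boxes. Then \[ \sum_{\mu\in M} f_{\alpha/\mu}\,f_{\beta/\mu} = \sum_{\lambda\in\Lambda} f_{\lambda/\alpha}\,f_{\lambda/\beta}. \]
   Context: The cylinder $\mathcal{C}_{k,n}$ is $\mathbb{Z}^2/(-k,n-k)\mathbb{Z}$; boxes are its elements (classes of points $(x,y)$, $x$ the row, $y$ the column). A cylindric partition is a weakly decreasing bi-infinite integer sequence $(\lambda_i)$ with $\lambda_i=\lambda_{i+k}+n-k$. A point $(x,y)$ is in $\lambda$ iff $y\le\lambda_x$. $\mu\subseteq\lambda$ means $\mu_i\le\lambda_i$ for all $i$; the boxes of $\lambda/\mu$ are those in $\lambda$ but not $\mu$. A semistandard cylindric tableau of shape $\lambda/\mu$ is a map from boxes of $\lambda/\mu$ to a totally ordered set, weakly increasing along plane rows and strictly increasing down plane columns (for points in $\lambda/\mu$). A standard cylindric tableau is one whose entries are exactly $1,2,\dots,p$ ($p$ the number of boxes), each used once. $f_{\lambda/\mu}$ is the number of standard cylindric tableaux of shape $\lambda/\mu$. -}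

module Defs where

open import Data.Nat as ℕ using (ℕ; zero; suc)
open import Data.Integer as ℤ using (ℤ; +_; _+_; _-_; _*_; -_)
open import Data.Fin using (Fin; zero; suc)
open import Data.Product using (Σ; _×_; _,_; proj₁; proj₂)
open import Relation.Binary.PropositionalEquality using (_≡_)
open import Relation.Nullary using (¬_)

record CylPart (k n : ℕ) : Set where
  field
    part       : ℤ → ℤ
    decreasing : ∀ i → part (i + + 1) ℤ.≤ part i
    periodic   : ∀ i → part i ≡ part (i + + k) + (+ n - + k)
open CylPart public

_≋_ : ∀ {k n} → CylPart k n → CylPart k n → Set
l₁ ≋ l₂ = ∀ i → part l₁ i ≡ part l₂ i

_⊆_ : ∀ {k n} → CylPart k n → CylPart k n → Set
mu ⊆ lam = ∀ i → part mu i ℤ.≤ part lam i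

-- points of Z², (x , y) with x the row and y the column
Point : Set
Point = ℤ × ℤ

-- two points represent the same box of C_{k,n} = Z² / (-k, n-k) Z
SameBox : (k n : ℕ) → Point → Point → Set
SameBox k n (x , y) (x' , y') =
  Σ ℤ λ t → (x' ≡ x + t * (- (+ k))) × (y' ≡ y + t * (+ n - + k))

InPart : ∀ {k n} → CylPart k n → Point → Set
InPart lam (x , y) = y ℤ.≤ part lam x

InSkew : ∀ {k n} → CylPart k n → CylPart k n → Point → Set
InSkew lam mu p = InPart lam p × ¬ InPart mu p

record IsEnum {A : Set} (_≈_ : A → A → Set) (P : A → Set) (c : ℕ)
              (e : Fin c → A) : Set where
  field
    enum-in   : ∀ i → P (e i)
    enum-inj  : ∀ i j → e i ≈ e j → i ≡ j
    enum-surj : ∀ a → P a → Σ (Fin c) λ i → e i ≈ a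

HasCard : {A : Set} (_≈_ : A → A → Set) (P : A → Set) (c : ℕ) → Set
HasCard {A} _≈_ P c = Σ (Fin c → A) λ e → IsEnum _≈_ P c e

NumBoxes : ∀ {k n} → CylPart k n → CylPart k n → ℕ → Set
NumBoxes {k} {n} lam mu m = HasCard (SameBox k n) (InSkew lam mu) m

-- A standard cylindric tableau of shape λ/μ, represented by a labelling of
-- points which is constant on boxes (on points of λ/μ).
Tableau : Set
Tableau = Point → ℕ

IsSYT : ∀ {k n} → CylPart k n → CylPart k n → Tableau → Set
IsSYT {k} {n} lam mu T =
  -- T is a function of boxes (classes of points) of λ/μ
  (∀ x y → InSkew lam mu (x , y) → T (x , y) ≡ T (x - + k , y + (+ n - + k)))
  × (∀ x y y' → y ℤ.< y' → InSkew lam mu (x , y) → InSkew lam mu (x , y')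
        → T (x , y) ℕ.≤ T (x , y'))
  × (∀ x x' y → x ℤ.< x' → InSkew lam mu (x , y) → InSkew lam mu (x' , y)
        → T (x , y) ℕ.< T (x' , y))
  × Σ ℕ λ p →
      (∀ b → InSkew lam mu b → (1 ℕ.≤ T b) × (T b ℕ.≤ p))
      × (∀ b b' → InSkew lam mu b → InSkew lam mu b' → T b ≡ T b'
           → SameBox k n b b')
      × (∀ j → 1 ℕ.≤ j → j ℕ.≤ p → Σ Point λ b → InSkew lam mu b × T b ≡ j)

SameTableau : ∀ {k n} → CylPart k n → CylPart k n → Tableau → Tableau → Set
SameTableau lam mu T T' = ∀ b → InSkew lam mu b → T b ≡ T' b

NumSYT : ∀ {k n} → CylPart k n → CylPart k n → ℕ → Set
NumSYT lam mu c = HasCard (SameTableau lam mu) (IsSYT lam mu) c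

InM : ∀ {k n} → CylPart k n → CylPart k n → ℕ → CylPart k n → Set
InM α β m mu = (mu ⊆ α) × (mu ⊆ β) × NumBoxes α mu m

InΛ : ∀ {k n} → CylPart k n → CylPart k n → ℕ → CylPart k n → Set
InΛ α β m lam = (α ⊆ lam) × (β ⊆ lam) × NumBoxes lam β m

∑ : (c : ℕ) → (Fin c → ℕ) → ℕ
∑ zero    g = 0
∑ (suc c) g = g zero ℕ.+ ∑ c (λ i → g (suc i))

-- Cylindric partitions form a graded poset in which U adds and D removes one box of the cylinder.
-- A class r ∈ ℤ/k is addable or removable according to the signs of the gaps λ_{r-1} - λ_r and
-- λ_r - λ_{r+1}; over one period both families of gaps are the same k numbers, so there are as many
-- addable as removable classes. Together with a bijection between the remaining add-then-remove and
-- remove-then-add moves this gives DU = UD. Deleting the largest entry of a standard tableau of shape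
-- λ/μ deletes a removable box of λ, so f_{λ/μ} counts the D-paths of length |λ/μ| from λ to μ. With
-- j = |β| - |α| + m, both sums count the paths from α to β of shape D^m U^j and U^j D^m respectively,
-- and these agree because DU = UD.

module Submission where

open import Data.Nat using (ℕ)
open import Defs

module IntegerFacts where

  open import Data.Nat using (ℕ; zero; suc)
  open import Data.Integer using (ℤ; +_; -[1+_]; ∣_∣; _+_; _-_; _*_; -_; 0ℤ; 1ℤ; _≤_; _<_)
  import Data.Integer.Properties as ℤP
  open import Data.Integer.Tactic.RingSolver using (solve; solve-∀)
  open import Data.List using (_∷_; [])
  open import Data.Product using (Σ; _×_; _,_)
  open import Data.Sum using (_⊎_; inj₁; inj₂)
  open import Relation.Nullary using (¬_)
  open import Relation.Binary.PropositionalEquality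

  ≤⇒≡+ℕ : ∀ {i j} → i ≤ j → Σ ℕ λ d → j ≡ i + + d
  ≤⇒≡+ℕ {i} {j} i≤j = ∣ j - i ∣ , (begin
    j               ≡⟨ solve (i ∷ j ∷ []) ⟩
    i + (j - i)     ≡⟨ cong (λ z → i + z) (sym (ℤP.0≤i⇒+∣i∣≡i (ℤP.i≤j⇒0≤j-i i≤j))) ⟩
    i + + ∣ j - i ∣ ∎)
    where open ≡-Reasoning

  i+j-j≡i : ∀ i j → i + j - j ≡ i
  i+j-j≡i i j = solve (i ∷ j ∷ [])

  i-j+j≡i : ∀ i j → i - j + j ≡ i
  i-j+j≡i i j = solve (i ∷ j ∷ [])

  [i-k]-[j-k]≡i-j : ∀ i j k → (i - k) - (j - k) ≡ i - j
  [i-k]-[j-k]≡i-j i j k = solve (i ∷ j ∷ k ∷ [])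

  0<i-j⇒j<i : ∀ {i j} → 0ℤ < i - j → j < i
  0<i-j⇒j<i {i} {j} 0<i-j = subst₂ _<_ (ℤP.+-identityˡ j) (i-j+j≡i i j) (ℤP.+-monoˡ-< j 0<i-j)

  0<i-j⇒j+1≤i : ∀ {i j} → 0ℤ < i - j → j + 1ℤ ≤ i
  0<i-j⇒j+1≤i {i} {j} 0<i-j = subst (_≤ i) (ℤP.+-comm 1ℤ j) (ℤP.i<j⇒suc[i]≤j (0<i-j⇒j<i 0<i-j))

  0<i-j⇒j≤i-1 : ∀ {i j} → 0ℤ < i - j → j ≤ i - 1ℤ
  0<i-j⇒j≤i-1 {i} {j} 0<i-j = subst (_≤ i - 1ℤ) (i+j-j≡i j 1ℤ) (ℤP.+-monoˡ-≤ (- 1ℤ) (0<i-j⇒j+1≤i {i} {j} 0<i-j))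

  j<i⇒0<i-j : ∀ {i j} → j < i → 0ℤ < i - j
  j<i⇒0<i-j {i} {j} j<i = subst (_< i - j) (ℤP.+-inverseʳ j) (ℤP.+-monoˡ-< (- j) j<i)

  i≤i+j : ∀ i {j} → 0ℤ ≤ j → i ≤ i + j
  i≤i+j i {j} 0≤j = subst (_≤ i + j) (ℤP.+-identityʳ i) (ℤP.+-monoʳ-≤ i 0≤j)

  i-j≤i : ∀ i {j} → 0ℤ ≤ j → i - j ≤ i
  i-j≤i i {j} 0≤j = subst (i - j ≤_) (ℤP.+-identityʳ i) (ℤP.+-monoʳ-≤ i (ℤP.neg-mono-≤ 0≤j))

  sub-≡-* : ∀ {a b c d} m → a + c * m ≡ b + d * m → a - b ≡ (d - c) * m
  sub-≡-* {a} {b} {c} {d} m eq = begin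
    a - b                                 ≡⟨ solve (a ∷ b ∷ c ∷ d ∷ m ∷ []) ⟩
    (a + c * m) - (b + d * m) + (d - c) * m ≡⟨ cong (λ z → z - (b + d * m) + (d - c) * m) eq ⟩
    (b + d * m) - (b + d * m) + (d - c) * m ≡⟨ solve (b ∷ c ∷ d ∷ m ∷ []) ⟩
    (d - c) * m                           ∎
    where open ≡-Reasoning

  iterate-shift : ∀ (f : ℤ → ℤ) a b → (∀ x → f (x + a) ≡ f x - b) → ∀ q x → f (x + q * a) ≡ f x - q * b
  iterate-shift f a b step = shift
    where
    open ≡-Reasoning
    one-more : ∀ x M c → x + (1ℤ + M) * c ≡ (x + M * c) + c
    one-more = solve-∀
    one-more′ : ∀ y M c → y - M * c - c ≡ y - (1ℤ + M) * c
    one-more′ = solve-∀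
    shiftℕ : ∀ m x → f (x + + m * a) ≡ f x - + m * b
    shiftℕ zero    x = trans (cong f (ℤP.+-identityʳ x)) (sym (ℤP.+-identityʳ (f x)))
    shiftℕ (suc m) x = begin
      f (x + (1ℤ + + m) * a)   ≡⟨ cong f (one-more x (+ m) a) ⟩
      f ((x + + m * a) + a)    ≡⟨ step _ ⟩
      f (x + + m * a) - b      ≡⟨ cong (_- b) (shiftℕ m x) ⟩
      f x - + m * b - b        ≡⟨ one-more′ (f x) (+ m) b ⟩
      f x - (1ℤ + + m) * b     ∎
    back-and-forth : ∀ x M c → x + (- M) * c + M * c ≡ x
    back-and-forth = solve-∀
    add-sub : ∀ y M c → y ≡ y - M * c + M * c
    add-sub = solve-∀
    neg-sub : ∀ y M c → y + M * c ≡ y - (- M) * c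
    neg-sub = solve-∀
    shift : ∀ q x → f (x + q * a) ≡ f x - q * b
    shift (+ m) x = shiftℕ m x
    shift -[1+ m ] x = begin
      f y                               ≡⟨ add-sub (f y) (+ suc m) b ⟩
      f y - + suc m * b + + suc m * b   ≡⟨ cong (_+ + suc m * b) (sym (shiftℕ (suc m) y)) ⟩
      f (y + + suc m * a) + + suc m * b ≡⟨ cong (λ z → f z + + suc m * b) (back-and-forth x (+ suc m) a) ⟩
      f x + + suc m * b                 ≡⟨ neg-sub (f x) (+ suc m) b ⟩
      f x - -[1+ m ] * b                ∎
      where y = x + -[1+ m ] * a

  i<i+1 : ∀ i → i < i + 1ℤ
  i<i+1 i = ℤP.suc[i]≤j⇒i<j (ℤP.≤-reflexive (ℤP.+-comm 1ℤ i))

  0<i+1-d : ∀ {i d} → 0ℤ ≤ i → d ≡ 0ℤ ⊎ (d ≡ 1ℤ × 0ℤ < i) → 0ℤ < i + 1ℤ - d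
  0<i+1-d {i} 0≤i (inj₁ refl)        = subst (0ℤ <_) (sym (ℤP.+-identityʳ (i + 1ℤ))) (ℤP.≤-<-trans 0≤i (i<i+1 i))
  0<i+1-d {i} 0≤i (inj₂ (refl , 0<i)) = subst (0ℤ <_) (sym (i+j-j≡i i 1ℤ)) 0<i

  0<-exchange : ∀ {A B d} → d ≡ 0ℤ ⊎ (d ≡ 1ℤ × A ≡ B) → 0ℤ < A → 0ℤ < B - d → 0ℤ < B × 0ℤ < A - d
  0<-exchange {A} {B} (inj₁ refl) 0<A 0<B-0 =
    subst (0ℤ <_) (ℤP.+-identityʳ B) 0<B-0 , subst (0ℤ <_) (sym (ℤP.+-identityʳ A)) 0<A
  0<-exchange {A} {B} (inj₂ (refl , refl)) 0<A 0<A-1 =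
    ℤP.<-trans 0<A-1 (subst (A - 1ℤ <_) (i-j+j≡i A 1ℤ) (i<i+1 (A - 1ℤ))) , 0<A-1

  i≡i+j⇒j≡0 : ∀ {i j} → i ≡ i + j → j ≡ 0ℤ
  i≡i+j⇒j≡0 {i} {j} eq = begin
    j             ≡⟨ solve (i ∷ j ∷ []) ⟩
    i + j - i     ≡⟨ cong (_- i) (sym eq) ⟩
    i - i         ≡⟨ ℤP.+-inverseʳ i ⟩
    0ℤ            ∎
    where open ≡-Reasoning

  i≰i-1 : ∀ i → ¬ (i ≤ i - 1ℤ)
  i≰i-1 i = ℤP.<⇒≱ (subst (i - 1ℤ <_) (i-j+j≡i i 1ℤ) (i<i+1 (i - 1ℤ)))

  ≤∧≰i-1⇒≡ : ∀ {j i} → j ≤ i → ¬ (j ≤ i - 1ℤ) → j ≡ i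
  ≤∧≰i-1⇒≡ {j} {i} j≤i j≰i-1 = ℤP.≤-antisym j≤i (subst (_≤ j) 1+[i-1]≡i (ℤP.i<j⇒suc[i]≤j (ℤP.≰⇒> j≰i-1)))
    where
    1+[i-1]≡i : 1ℤ + (i - 1ℤ) ≡ i
    1+[i-1]≡i = solve (i ∷ [])

  offset-unique : ∀ {s t u x y z} → u ≡ s + x → t ≡ s + y → u + z ≡ t + x → y ≡ z
  offset-unique {s} {t} {u} {x} {y} {z} u≡ t≡ eq = begin
    y                     ≡⟨ solve (s ∷ x ∷ y ∷ []) ⟩
    (s + y + x) - (s + x) ≡⟨ cong₂ (λ a b → a + x - b) (sym t≡) (sym u≡) ⟩
    (t + x) - u           ≡⟨ cong (_- u) (sym eq) ⟩
    (u + z) - u           ≡⟨ solve (u ∷ z ∷ []) ⟩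
    z                     ∎
    where open ≡-Reasoning

module FiniteSums where

  open import Data.Nat using (ℕ; zero; suc; _+_; _*_)
  import Data.Nat.Properties as ℕP
  open import Data.Fin using (Fin; zero; suc; punchIn)
  import Data.Fin.Properties as FP
  open import Data.Product using (Σ; _,_; proj₁; proj₂)
  open import Data.Empty using (⊥-elim)
  open import Relation.Nullary using (¬_; Dec; yes; no; Irrelevant)
  open import Relation.Binary.PropositionalEquality
  open import Algebra.Properties.Semiring.Sum ℕP.+-*-semiring public
    using (sum; sum-cong-≗; sum-replicate-zero; sum-init-last; ∑-distrib-+; ∑-comm; *-distribʳ-sum)
  open import Algebra.Properties.Semiring.Sum ℕP.+-*-semiring using (sum-remove)

  ∑≡sum : ∀ c (g : Fin c → ℕ) → ∑ c g ≡ sum g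
  ∑≡sum zero    g = refl
  ∑≡sum (suc c) g = cong (g zero +_) (∑≡sum c (λ i → g (suc i)))

  sum-≡0 : ∀ {c} {g : Fin c → ℕ} → (∀ i → g i ≡ 0) → sum g ≡ 0
  sum-≡0 {c} g≡0 = trans (sum-cong-≗ g≡0) (sum-replicate-zero c)

  sum-single : ∀ {c} (g : Fin c → ℕ) (r : Fin c) → (∀ s → s ≢ r → g s ≡ 0) → sum g ≡ g r
  sum-single {suc c} g r g≡0 = begin
    sum g                              ≡⟨ sum-remove {i = r} g ⟩
    g r + sum (λ i → g (punchIn r i)) ≡⟨ cong (g r +_) (sum-≡0 (λ i → g≡0 _ (FP.punchInᵢ≢i r i))) ⟩
    g r + 0                            ≡⟨ ℕP.+-identityʳ (g r) ⟩
    g r                                ∎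
    where open ≡-Reasoning

  sum≢0⇒∃≢0 : ∀ {c} (g : Fin c → ℕ) → sum g ≢ 0 → Σ (Fin c) λ i → g i ≢ 0
  sum≢0⇒∃≢0 {zero}  g sum≢0 = ⊥-elim (sum≢0 refl)
  sum≢0⇒∃≢0 {suc c} g sum≢0 with g zero ℕP.≟ 0
  ... | no g₀≢0 = zero , g₀≢0
  ... | yes g₀≡0 with sum≢0⇒∃≢0 (λ i → g (suc i)) (λ rest≡0 → sum≢0 (cong₂ _+_ g₀≡0 rest≡0))
  ...   | i , gᵢ≢0 = suc i , gᵢ≢0

  given : ∀ {A : Set} → Dec A → (A → ℕ) → ℕ
  given (yes a) f = f a
  given (no _)  f = 0

  indicator : ∀ {A : Set} → Dec A → ℕ
  indicator d = given d (λ _ → 1)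

  given-cong : ∀ {A : Set} (d : Dec A) {f g : A → ℕ} → (∀ a → f a ≡ g a) → given d f ≡ given d g
  given-cong (yes a) f≡g = f≡g a
  given-cong (no _)  f≡g = refl

  given-↔ : ∀ {A B : Set} (dA : Dec A) (dB : Dec B) → (A → B) → (B → A) →
            (f : A → ℕ) (g : B → ℕ) → (∀ a b → f a ≡ g b) → given dA f ≡ given dB g
  given-↔ (yes a) (yes b) _  _  f g f≡g = f≡g a b
  given-↔ (yes a) (no ¬b) ab _  f g f≡g = ⊥-elim (¬b (ab a))
  given-↔ (no ¬a) (yes b) _  ba f g f≡g = ⊥-elim (¬a (ba b))
  given-↔ (no _)  (no _)  _  _  f g f≡g = refl

  given-yes : ∀ {A : Set} (d : Dec A) (f : A → ℕ) → Irrelevant A → (a : A) → given d f ≡ f a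
  given-yes (yes a′) f irr a = cong f (irr a′ a)
  given-yes (no ¬a)  f irr a = ⊥-elim (¬a a)

  given-const : ∀ {A : Set} (d : Dec A) {x} → A → given d (λ _ → x) ≡ x
  given-const (yes _) a = refl
  given-const (no ¬a) a = ⊥-elim (¬a a)

  given-no : ∀ {A : Set} (d : Dec A) (f : A → ℕ) → ¬ A → given d f ≡ 0
  given-no (yes a) f ¬a = ⊥-elim (¬a a)
  given-no (no _)  f ¬a = refl

  given-≡0 : ∀ {A : Set} (d : Dec A) (f : A → ℕ) → (∀ a → f a ≡ 0) → given d f ≡ 0
  given-≡0 (yes a) f f≡0 = f≡0 a
  given-≡0 (no _)  f f≡0 = refl

  given≢0⇒∃≢0 : ∀ {A : Set} (d : Dec A) (f : A → ℕ) → given d f ≢ 0 → Σ A λ a → f a ≢ 0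
  given≢0⇒∃≢0 (yes a) f ≢0 = a , ≢0
  given≢0⇒∃≢0 (no _)  f ≢0 = ⊥-elim (≢0 refl)

  given-sum : ∀ {A : Set} (d : Dec A) {c} (F : A → Fin c → ℕ) →
              given d (λ a → sum (F a)) ≡ sum (λ i → given d (λ a → F a i))
  given-sum (yes a) F = refl
  given-sum (no _) {c} F = sym (sum-replicate-zero c)

  given-comm : ∀ {A B : Set} (dA : Dec A) (dB : Dec B) (F : A → B → ℕ) →
               given dA (λ a → given dB (F a)) ≡ given dB (λ b → given dA (λ a → F a b))
  given-comm (yes a) (yes b) F = refl
  given-comm (yes a) (no _)  F = refl
  given-comm (no _)  (yes b) F = refl
  given-comm (no _)  (no _)  F = refl

  given-*ʳ : ∀ {A : Set} (d : Dec A) (f : A → ℕ) m → given d f * m ≡ given d (λ a → f a * m)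
  given-*ʳ (yes a) f m = refl
  given-*ʳ (no _)  f m = refl

  given²-↔ : ∀ {A C : Set} {B : A → Set} {D : C → Set} → Irrelevant A → Irrelevant C →
             (dA : Dec A) (dB : ∀ a → Dec (B a)) (dC : Dec C) (dD : ∀ c → Dec (D c)) →
             (f : ∀ a → B a → ℕ) (h : ∀ c → D c → ℕ) →
             (∀ a → B a → Σ C D) → (∀ c → D c → Σ A B) → (∀ a b c d → f a b ≡ h c d) →
             given dA (λ a → given (dB a) (f a)) ≡ given dC (λ c → given (dD c) (h c))
  given²-↔ {B = B} {D} irrA irrC dA dB dC dD f h to from f≡h with dA
  ... | no ¬a = sym (given-≡0 dC _ (λ c → given-no (dD c) (h c) (λ d → ¬a (proj₁ (from c d)))))
  ... | yes a with dB a
  ...   | no ¬b = sym (given-≡0 dC _ (λ c → given-no (dD c) (h c) (λ d → ¬b (subst B (irrA _ a) (proj₂ (from c d))))))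
  ...   | yes b with to a b | dC
  ...     | c′ , _  | no ¬c = ⊥-elim (¬c c′)
  ...     | c′ , d′ | yes c with dD c
  ...       | no ¬d = ⊥-elim (¬d (subst D (irrC c′ c) d′))
  ...       | yes d = f≡h a b c d

  *-congˡ-≢0 : ∀ a {b b′} → (a ≢ 0 → b ≡ b′) → a * b ≡ a * b′
  *-congˡ-≢0 zero    b≡b′ = refl
  *-congˡ-≢0 (suc a) b≡b′ = cong (suc a *_) (b≡b′ (λ ()))

  *-congʳ-≢0 : ∀ {a a′} b → (b ≢ 0 → a ≡ a′) → a * b ≡ a′ * b
  *-congʳ-≢0 {a} {a′} b a≡a′ = trans (ℕP.*-comm a b) (trans (*-congˡ-≢0 b a≡a′) (ℕP.*-comm b a′))

module Enumerations where

  open import Data.Nat using (ℕ; zero; suc; _≤_)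
  import Data.Nat.Properties as ℕP
  open import Data.Fin as F using (Fin; _↑ˡ_; _↑ʳ_)
  import Data.Fin.Properties as FP
  open import Data.Product using (Σ; _,_; proj₁; proj₂)
  open import Data.Sum using (inj₁; inj₂)
  open import Relation.Binary.Definitions using (Symmetric; Transitive)
  open import Relation.Binary.PropositionalEquality
  open FiniteSums using (sum)

  module _ {A : Set} {_≈_ : A → A → Set} {P : A → Set} (sym≈ : Symmetric _≈_) (trans≈ : Transitive _≈_) where

    enum-size-≤ : ∀ {c₁ c₂ e₁ e₂} → IsEnum _≈_ P c₁ e₁ → IsEnum _≈_ P c₂ e₂ → c₁ ≤ c₂
    enum-size-≤ {c₁} {c₂} {e₁} {e₂} E₁ E₂ = FP.injective⇒≤ {f = index} index-injective
      where
      open IsEnum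
      index : Fin c₁ → Fin c₂
      index i = proj₁ (enum-surj E₂ (e₁ i) (enum-in E₁ i))
      index-correct : ∀ i → e₂ (index i) ≈ e₁ i
      index-correct i = proj₂ (enum-surj E₂ (e₁ i) (enum-in E₁ i))
      index-injective : ∀ {i j} → index i ≡ index j → i ≡ j
      index-injective {i} {j} eq =
        enum-inj E₁ i j (trans≈ (sym≈ (index-correct i)) (subst (λ z → e₂ z ≈ e₁ j) (sym eq) (index-correct j)))

    enum-size-unique : ∀ {c₁ c₂ e₁ e₂} → IsEnum _≈_ P c₁ e₁ → IsEnum _≈_ P c₂ e₂ → c₁ ≡ c₂
    enum-size-unique E₁ E₂ = ℕP.≤-antisym (enum-size-≤ E₁ E₂) (enum-size-≤ E₂ E₁)

  split : ∀ {m} (g : Fin m → ℕ) → Fin (sum g) → Σ (Fin m) (λ r → Fin (g r))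
  split {suc m} g x with F.splitAt (g F.zero) x
  ... | inj₁ j = F.zero , j
  ... | inj₂ x′ with split (λ i → g (F.suc i)) x′
  ...   | r , j = F.suc r , j

  join : ∀ {m} (g : Fin m → ℕ) (r : Fin m) → Fin (g r) → Fin (sum g)
  join {suc m} g F.zero    j = j ↑ˡ _
  join {suc m} g (F.suc r) j = g F.zero ↑ʳ join (λ i → g (F.suc i)) r j

  split-join : ∀ {m} (g : Fin m → ℕ) r j → split g (join g r j) ≡ (r , j)
  split-join {suc m} g F.zero j rewrite FP.splitAt-↑ˡ (g F.zero) j (sum (λ i → g (F.suc i))) = refl
  split-join {suc m} g (F.suc r) j
    rewrite FP.splitAt-↑ʳ (g F.zero) (sum (λ i → g (F.suc i))) (join (λ i → g (F.suc i)) r j)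
          | split-join (λ i → g (F.suc i)) r j = refl

  join-split : ∀ {m} (g : Fin m → ℕ) x → join g (proj₁ (split g x)) (proj₂ (split g x)) ≡ x
  join-split {suc m} g x with F.splitAt (g F.zero) x in eq
  ... | inj₁ j = FP.splitAt⁻¹-↑ˡ eq
  ... | inj₂ x′ with split (λ i → g (F.suc i)) x′ in eq′
  ...   | r , j = trans (cong (g F.zero ↑ʳ_) (trans (cong (λ u → join (λ i → g (F.suc i)) (proj₁ u) (proj₂ u)) (sym eq′))
                                                     (join-split (λ i → g (F.suc i)) x′)))
                        (FP.splitAt⁻¹-↑ʳ eq)

  record FibreEnum {A : Set} (_≈_ : A → A → Set) (P : A → Set) {m : ℕ} (cls : ∀ a → P a → Fin m) (r : Fin m) : Set where
    field
      size     : ℕ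
      el       : Fin size → A
      el-in    : ∀ j → P (el j)
      el-cls   : ∀ j pa → cls (el j) pa ≡ r
      el-inj   : ∀ j j′ → el j ≈ el j′ → j ≡ j′
      el-surj  : ∀ a (pa : P a) → cls a pa ≡ r → Σ (Fin size) λ j → el j ≈ a

  HasCard-fibres : ∀ {A : Set} {_≈_ : A → A → Set} {P : A → Set} {m : ℕ} (cls : ∀ a → P a → Fin m) →
                   (∀ a b (pa : P a) (pb : P b) → a ≈ b → cls a pa ≡ cls b pb) →
                   (fibre : ∀ r → FibreEnum _≈_ P cls r) →
                   HasCard _≈_ P (sum (λ r → FibreEnum.size (fibre r)))
  HasCard-fibres {A} {_≈_} {P} {m} cls cls-resp fibre = e , record { enum-in = e-in ; enum-inj = e-inj ; enum-surj = e-surj }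
    where
    open FibreEnum
    g : Fin m → ℕ
    g r = size (fibre r)
    E : Σ (Fin m) (λ r → Fin (g r)) → A
    E (r , j) = el (fibre r) j
    e : Fin (sum g) → A
    e x = E (split g x)
    e-in : ∀ x → P (e x)
    e-in x = el-in (fibre (proj₁ (split g x))) (proj₂ (split g x))
    E-inj : ∀ u v → E u ≈ E v → u ≡ v
    E-inj (r , j) (r′ , j′) eq
      with trans (sym (el-cls (fibre r) j (el-in (fibre r) j)))
                 (trans (cls-resp _ _ (el-in (fibre r) j) (el-in (fibre r′) j′) eq) (el-cls (fibre r′) j′ (el-in (fibre r′) j′)))
    ... | refl = cong (r ,_) (el-inj (fibre r) j j′ eq)
    e-inj : ∀ x y → e x ≈ e y → x ≡ y
    e-inj x y eq = trans (sym (join-split g x)) (trans (cong (λ u → join g (proj₁ u) (proj₂ u)) (E-inj _ _ eq)) (join-split g y))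
    e-surj : ∀ a → P a → Σ (Fin (sum g)) λ x → e x ≈ a
    e-surj a pa with el-surj (fibre (cls a pa)) a pa refl
    ... | j , ej = join g (cls a pa) j , subst (λ u → E u ≈ a) (sym (split-join g (cls a pa) j)) ej

module Cylinder (k′ n : ℕ) where

  open import Data.Nat as ℕ using (zero; suc; s≤s; z≤n)
  import Data.Nat.Properties as ℕP
  open import Data.Integer as ℤ using (ℤ; +_; -[1+_]; ∣_∣; _+_; _-_; _*_; -_; 0ℤ; 1ℤ; _%ℕ_; _/ℕ_)
  import Data.Integer.Properties as ℤP
  open import Data.Integer.DivMod using (n%ℕd<d; a≡a%ℕn+[a/ℕn]*n)
  open import Data.Integer.Tactic.RingSolver using (solve-∀)
  open import Data.Fin as F using (Fin; toℕ)
  import Data.Fin.Properties as FP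
  open import Data.Product using (Σ; _×_; _,_; proj₁; proj₂)
  open import Data.Sum using (_⊎_; inj₁; inj₂)
  open import Data.Empty using (⊥; ⊥-elim)
  open import Relation.Nullary using (¬_; Dec; yes; no)
  open import Relation.Nullary.Decidable using (map′; decidable-stable)
  open import Relation.Binary.PropositionalEquality
  open import Algebra.Properties.CommutativeSemigroup ℤP.+-commutativeSemigroup using (xy∙z≈xz∙y)
  open import Algebra.Properties.AbelianGroup ℤP.+-0-abelianGroup using (∙-cancelˡ; ∙-cancelʳ)
  import Algebra.Properties.CommutativeMonoid.Sum ℤP.+-0-commutativeMonoid as ℤΣ
  open IntegerFacts
  open FiniteSums
  open Enumerations

  -- Residues modulo k and single-box moves

  k : ℕ
  k = suc k′

  K : ℤ
  K = + k

  w : ℤ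
  w = + n - + k

  res : ℤ → ℕ
  res x = x %ℕ k

  quo : ℤ → ℤ
  quo x = x /ℕ k

  res<k : ∀ x → res x ℕ.< k
  res<k x = n%ℕd<d x k

  res+quo : ∀ x → x ≡ + res x + quo x * K
  res+quo x = a≡a%ℕn+[a/ℕn]*n x k

  <k-diff-multiple⇒≡ : ∀ {a b} c → a ℕ.< k → b ℕ.< k → + a - + b ≡ c * K → a ≡ b
  <k-diff-multiple⇒≡ {a} {b} c a<k b<k eq = ℤP.+-injective (ℤP.i-j≡0⇒i≡j (+ a) (+ b) (trans eq (cong (_* K) (ℤP.∣i∣≡0⇒i≡0 {c} ∣c∣≡0))))
    where
    ∣a-b∣<k : ∣ + a - + b ∣ ℕ.< k
    ∣a-b∣<k = ℕP.≤-<-trans (subst (ℕ._≤ a ℕ.⊔ b) (cong ∣_∣ (sym (ℤP.[+m]-[+n]≡m⊖n a b))) (ℤP.∣m⊝n∣≤m⊔n a b))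
                           (ℕP.⊔-lub a<k b<k)
    ∣c∣*k<1*k : ∣ c ∣ ℕ.* k ℕ.< 1 ℕ.* k
    ∣c∣*k<1*k = subst₂ ℕ._<_ (trans (cong ∣_∣ eq) (ℤP.abs-* c K)) (sym (ℕP.*-identityˡ k)) ∣a-b∣<k
    ∣c∣≡0 : ∣ c ∣ ≡ 0
    ∣c∣≡0 = ℕP.n<1⇒n≡0 (ℕP.*-cancelʳ-< k ∣ c ∣ 1 ∣c∣*k<1*k)

  res-unique : ∀ r q → r ℕ.< k → res (+ r + q * K) ≡ r
  res-unique r q r<k = sym (<k-diff-multiple⇒≡ (quo x - q) r<k (res<k x) (sub-≡-* {+ r} {+ res x} {q} {quo x} K (res+quo x)))
    where x = + r + q * K

  res-shift : ∀ x q → res (x + q * K) ≡ res x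
  res-shift x q = trans (cong res (trans (cong (_+ q * K) (res+quo x)) (regroup (+ res x) (quo x))))
                        (res-unique (res x) (quo x + q) (res<k x))
    where
    regroup : ∀ r p → r + p * K + q * K ≡ r + (p + q) * K
    regroup r p = trans (ℤP.+-assoc r _ _) (cong (λ z → r + z) (sym (ℤP.*-distribʳ-+ K p q)))

  res-≡⇒shift : ∀ x y → res x ≡ res y → y ≡ x + (quo y - quo x) * K
  res-≡⇒shift x y eq = begin
    y                                         ≡⟨ res+quo y ⟩
    + res y + quo y * K                       ≡⟨ cong (λ r → + r + quo y * K) (sym eq) ⟩
    + res x + quo y * K                       ≡⟨ regroup (+ res x) (quo x) (quo y) K ⟩
    (+ res x + quo x * K) + (quo y - quo x) * K ≡⟨ cong (_+ (quo y - quo x) * K) (sym (res+quo x)) ⟩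
    x + (quo y - quo x) * K                   ∎
    where
    open ≡-Reasoning
    regroup : ∀ r p q m → r + q * m ≡ (r + p * m) + (q - p) * m
    regroup = solve-∀

  res-cong-+ : ∀ x y z → res x ≡ res y → res (x + z) ≡ res (y + z)
  res-cong-+ x y z eq = begin
    res (x + z)                          ≡⟨ sym (res-shift (x + z) (quo y - quo x)) ⟩
    res (x + z + (quo y - quo x) * K)    ≡⟨ cong res (xy∙z≈xz∙y x z _) ⟩
    res (x + (quo y - quo x) * K + z)    ≡⟨ cong (λ u → res (u + z)) (sym (res-≡⇒shift x y eq)) ⟩
    res (y + z)                          ∎
    where open ≡-Reasoning

  ρ : Fin k → ℤ
  ρ r = + toℕ r

  res-ρ : ∀ r → res (ρ r) ≡ toℕ r
  res-ρ r = trans (cong res (sym (ℤP.+-identityʳ (ρ r)))) (res-unique (toℕ r) 0ℤ (FP.toℕ<n r))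

  χ : ∀ {A : Set} → Dec A → ℤ
  χ (yes _) = 1ℤ
  χ (no _)  = 0ℤ

  χ-↔ : ∀ {A B : Set} → (A → B) → (B → A) → (dA : Dec A) (dB : Dec B) → χ dA ≡ χ dB
  χ-↔ f g (yes a) (yes b) = refl
  χ-↔ f g (yes a) (no ¬b) = ⊥-elim (¬b (f a))
  χ-↔ f g (no ¬a) (yes b) = ⊥-elim (¬a (g b))
  χ-↔ f g (no ¬a) (no ¬b) = refl

  χ-nonneg : ∀ {A : Set} (d : Dec A) → 0ℤ ℤ.≤ χ d
  χ-nonneg (yes _) = ℤ.+≤+ ℕ.z≤n
  χ-nonneg (no _)  = ℤP.≤-refl

  χ-yes : ∀ {A : Set} → A → (d : Dec A) → χ d ≡ 1ℤ
  χ-yes a (yes _) = refl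
  χ-yes a (no ¬a) = ⊥-elim (¬a a)

  χ-no : ∀ {A : Set} → ¬ A → (d : Dec A) → χ d ≡ 0ℤ
  χ-no ¬a (yes a) = ⊥-elim (¬a a)
  χ-no ¬a (no _)  = refl

  χ-cases : ∀ {A : Set} (d : Dec A) → (A × χ d ≡ 1ℤ) ⊎ χ d ≡ 0ℤ
  χ-cases (yes a) = inj₁ (a , refl)
  χ-cases (no _)  = inj₂ refl

  -- Adding δ r to the parts adds one box of the cylinder, in every row ≡ r (mod k).
  δ : Fin k → ℤ → ℤ
  δ r x = χ (res x ℕ.≟ toℕ r)

  δ-cong : ∀ r x y → res x ≡ res y → δ r x ≡ δ r y
  δ-cong r x y x≡y = χ-↔ (trans (sym x≡y)) (trans x≡y) _ _

  δ-self : ∀ r → δ r (ρ r) ≡ 1ℤ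
  δ-self r = χ-yes (res-ρ r) _

  δ-other : ∀ r s → r ≢ s → δ r (ρ s) ≡ 0ℤ
  δ-other r s r≢s = χ-no (λ eq → r≢s (FP.toℕ-injective (trans (sym eq) (res-ρ s)))) _

  δ-nonneg : ∀ r x → 0ℤ ℤ.≤ δ r x
  δ-nonneg r x = χ-nonneg _

  δ-swap : ∀ r s → δ r (ρ s + 1ℤ) ≡ δ s (ρ r - 1ℤ)
  δ-swap r s = χ-↔ to from _ _
    where
    to : res (ρ s + 1ℤ) ≡ toℕ r → res (ρ r - 1ℤ) ≡ toℕ s
    to eq = begin
      res (ρ r - 1ℤ)         ≡⟨ sym (res-cong-+ (ρ s + 1ℤ) (ρ r) (- 1ℤ) (trans eq (sym (res-ρ r)))) ⟩
      res (ρ s + 1ℤ - 1ℤ)    ≡⟨ cong res (i+j-j≡i (ρ s) 1ℤ) ⟩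
      res (ρ s)              ≡⟨ res-ρ s ⟩
      toℕ s                  ∎
      where open ≡-Reasoning
    from : res (ρ r - 1ℤ) ≡ toℕ s → res (ρ s + 1ℤ) ≡ toℕ r
    from eq = begin
      res (ρ s + 1ℤ)         ≡⟨ sym (res-cong-+ (ρ r - 1ℤ) (ρ s) 1ℤ (trans eq (sym (res-ρ s)))) ⟩
      res (ρ r - 1ℤ + 1ℤ)    ≡⟨ cong res (i-j+j≡i (ρ r) 1ℤ) ⟩
      res (ρ r)              ≡⟨ res-ρ r ⟩
      toℕ r                  ∎
      where open ≡-Reasoning

  res-+K : ∀ x → res (x + K) ≡ res x
  res-+K x = trans (cong (λ z → res (x + z)) (sym (ℤP.*-identityˡ K))) (res-shift x 1ℤ)

  δ-periodic : ∀ r x → δ r (x + K) ≡ δ r x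
  δ-periodic r x = δ-cong r (x + K) x (res-+K x)

  part-shift : ∀ (c : CylPart k n) q x → part c (x + q * K) ≡ part c x - q * w
  part-shift c = iterate-shift (part c) K w step
    where
    step : ∀ x → part c (x + K) ≡ part c x - w
    step x = trans (sym (i+j-j≡i (part c (x + K)) w)) (cong (_- w) (sym (periodic c x)))

  gap : CylPart k n → ℤ → ℤ
  gap c x = part c x - part c (x + 1ℤ)

  gap-nonneg : ∀ c x → 0ℤ ℤ.≤ gap c x
  gap-nonneg c x = ℤP.i≤j⇒0≤j-i (decreasing c x)

  gap-shift : ∀ c q x → gap c (x + q * K) ≡ gap c x
  gap-shift c q x = begin
    part c (x + q * K) - part c (x + q * K + 1ℤ)   ≡⟨ cong (λ z → part c (x + q * K) - part c z) (xy∙z≈xz∙y x (q * K) 1ℤ) ⟩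
    part c (x + q * K) - part c (x + 1ℤ + q * K)   ≡⟨ cong₂ _-_ (part-shift c q x) (part-shift c q (x + 1ℤ)) ⟩
    (part c x - q * w) - (part c (x + 1ℤ) - q * w) ≡⟨ [i-k]-[j-k]≡i-j (part c x) (part c (x + 1ℤ)) (q * w) ⟩
    gap c x                                        ∎
    where open ≡-Reasoning

  gap-res : ∀ c x y → res x ≡ res y → gap c x ≡ gap c y
  gap-res c x y x≡y = trans (sym (gap-shift c (quo y - quo x) x)) (cong (gap c) (sym (res-≡⇒shift x y x≡y)))

  -- A box can be added to row ρ r when the row above is longer, and removed when the row below is shorter.
  Addable : CylPart k n → Fin k → Set
  Addable c r = 0ℤ ℤ.< gap c (ρ r - 1ℤ)

  Removable : CylPart k n → Fin k → Set
  Removable c r = 0ℤ ℤ.< gap c (ρ r)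

  Addable? : ∀ c r → Dec (Addable c r)
  Addable? c r = 0ℤ ℤ.<? gap c (ρ r - 1ℤ)

  Removable? : ∀ c r → Dec (Removable c r)
  Removable? c r = 0ℤ ℤ.<? gap c (ρ r)

  res-pred : ∀ r x → res (x + 1ℤ) ≡ toℕ r → res x ≡ res (ρ r - 1ℤ)
  res-pred r x eq = trans (cong res (sym (i+j-j≡i x 1ℤ))) (res-cong-+ (x + 1ℤ) (ρ r) (- 1ℤ) (trans eq (sym (res-ρ r))))

  add-step : ∀ c r → Addable c r → ∀ i → part c (i + 1ℤ) + δ r (i + 1ℤ) ℤ.≤ part c i
  add-step c r a i with χ-cases (res (i + 1ℤ) ℕ.≟ toℕ r)
  ... | inj₂ δ≡0       = subst (ℤ._≤ part c i) (sym (trans (cong (λ d → part c (i + 1ℤ) + d) δ≡0) (ℤP.+-identityʳ (part c (i + 1ℤ))))) (decreasing c i)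
  ... | inj₁ (eq , δ≡1) = subst (λ d → part c (i + 1ℤ) + d ℤ.≤ part c i) (sym δ≡1)
                                (0<i-j⇒j+1≤i {part c i} (subst (0ℤ ℤ.<_) (sym (gap-res c i (ρ r - 1ℤ) (res-pred r i eq))) a))

  rem-step : ∀ c r → Removable c r → ∀ i → part c (i + 1ℤ) ℤ.≤ part c i - δ r i
  rem-step c r q i with χ-cases (res i ℕ.≟ toℕ r)
  ... | inj₂ δ≡0       = subst (part c (i + 1ℤ) ℤ.≤_) (sym (trans (cong (λ d → part c i - d) δ≡0) (ℤP.+-identityʳ (part c i)))) (decreasing c i)
  ... | inj₁ (eq , δ≡1) = subst (λ d → part c (i + 1ℤ) ℤ.≤ part c i - d) (sym δ≡1)
                                (0<i-j⇒j≤i-1 {part c i} (subst (0ℤ ℤ.<_) (sym (gap-res c i (ρ r) (trans eq (sym (res-ρ r))))) q))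

  perturb : (c : CylPart k n) (f : ℤ → ℤ) → (∀ i → f (i + K) ≡ f i) →
            (∀ i → part c (i + 1ℤ) + f (i + 1ℤ) ℤ.≤ part c i + f i) → CylPart k n
  perturb c f f-periodic f-decreasing = record
    { part       = λ i → part c i + f i
    ; decreasing = f-decreasing
    ; periodic   = λ i → begin
        part c i + f i                   ≡⟨ cong₂ _+_ (periodic c i) (sym (f-periodic i)) ⟩
        part c (i + K) + w + f (i + K)   ≡⟨ xy∙z≈xz∙y (part c (i + K)) w (f (i + K)) ⟩
        part c (i + K) + f (i + K) + w   ∎
    }
    where open ≡-Reasoning

  add : (c : CylPart k n) (r : Fin k) → Addable c r → CylPart k n
  add c r a = perturb c (δ r) (δ-periodic r)
                      (λ i → ℤP.≤-trans (add-step c r a i) (i≤i+j (part c i) (δ-nonneg r i)))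

  rem : (c : CylPart k n) (r : Fin k) → Removable c r → CylPart k n
  rem c r q = perturb c (λ i → - δ r i) (λ i → cong -_ (δ-periodic r i))
                      (λ i → ℤP.≤-trans (i-j≤i (part c (i + 1ℤ)) (δ-nonneg r (i + 1ℤ))) (rem-step c r q i))

  gap-add : ∀ c r a x → gap (add c r a) x ≡ gap c x + δ r x - δ r (x + 1ℤ)
  gap-add c r a x = regroup (part c x) (part c (x + 1ℤ)) (δ r x) (δ r (x + 1ℤ))
    where
    regroup : ∀ p p′ d d′ → (p + d) - (p′ + d′) ≡ (p - p′) + d - d′
    regroup = solve-∀

  gap-rem : ∀ c r q x → gap (rem c r q) x ≡ gap c x - δ r x + δ r (x + 1ℤ)
  gap-rem c r q x = regroup (part c x) (part c (x + 1ℤ)) (δ r x) (δ r (x + 1ℤ))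
    where
    regroup : ∀ p p′ d d′ → (p - d) - (p′ - d′) ≡ (p - p′) - d + d′
    regroup = solve-∀

  add-Removable : ∀ c r (a : Addable c r) → Removable (add c r a) r
  add-Removable c r a = subst (0ℤ ℤ.<_) (sym gap≡) (0<i+1-d (gap-nonneg c (ρ r)) cases)
    where
    d = δ r (ρ r + 1ℤ)
    gap≡ : gap (add c r a) (ρ r) ≡ gap c (ρ r) + 1ℤ - d
    gap≡ = trans (gap-add c r a (ρ r)) (cong (λ z → gap c (ρ r) + z - d) (δ-self r))
    cases : d ≡ 0ℤ ⊎ (d ≡ 1ℤ × 0ℤ ℤ.< gap c (ρ r))
    cases with χ-cases (res (ρ r + 1ℤ) ℕ.≟ toℕ r)
    ... | inj₂ d≡0       = inj₁ d≡0
    ... | inj₁ (eq , d≡1) = inj₂ (d≡1 , subst (0ℤ ℤ.<_) (sym (gap-res c (ρ r) (ρ r - 1ℤ) (res-pred r (ρ r) eq))) a)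

  rem-Addable : ∀ c r (q : Removable c r) → Addable (rem c r q) r
  rem-Addable c r q = subst (0ℤ ℤ.<_) (sym gap≡) (0<i+1-d (gap-nonneg c (ρ r - 1ℤ)) cases)
    where
    d = δ r (ρ r - 1ℤ)
    gap≡ : gap (rem c r q) (ρ r - 1ℤ) ≡ gap c (ρ r - 1ℤ) + 1ℤ - d
    gap≡ = begin
      gap (rem c r q) (ρ r - 1ℤ)                        ≡⟨ gap-rem c r q (ρ r - 1ℤ) ⟩
      gap c (ρ r - 1ℤ) - d + δ r (ρ r - 1ℤ + 1ℤ)        ≡⟨ cong (λ z → gap c (ρ r - 1ℤ) - d + δ r z) (i-j+j≡i (ρ r) 1ℤ) ⟩
      gap c (ρ r - 1ℤ) - d + δ r (ρ r)                  ≡⟨ cong (λ z → gap c (ρ r - 1ℤ) - d + z) (δ-self r) ⟩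
      gap c (ρ r - 1ℤ) - d + 1ℤ                         ≡⟨ xy∙z≈xz∙y (gap c (ρ r - 1ℤ)) (- d) 1ℤ ⟩
      gap c (ρ r - 1ℤ) + 1ℤ - d                         ∎
      where open ≡-Reasoning
    cases : d ≡ 0ℤ ⊎ (d ≡ 1ℤ × 0ℤ ℤ.< gap c (ρ r - 1ℤ))
    cases with χ-cases (res (ρ r - 1ℤ) ℕ.≟ toℕ r)
    ... | inj₂ d≡0       = inj₁ d≡0
    ... | inj₁ (eq , d≡1) = inj₂ (d≡1 , subst (0ℤ ℤ.<_) (sym (gap-res c (ρ r - 1ℤ) (ρ r) (trans eq (sym (res-ρ r))))) q)

  rem-add-≋ : ∀ c r a q → rem (add c r a) r q ≋ c
  rem-add-≋ c r a q x = i+j-j≡i (part c x) (δ r x)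

  add-rem-≋ : ∀ c r q a → add (rem c r q) r a ≋ c
  add-rem-≋ c r q a x = i-j+j≡i (part c x) (δ r x)

  add-⊇ : ∀ c r a → c ⊆ add c r a
  add-⊇ c r a x = i≤i+j (part c x) (δ-nonneg r x)

  rem-⊆ : ∀ c r q → rem c r q ⊆ c
  rem-⊆ c r q x = i-j≤i (part c x) (δ-nonneg r x)

  gap-≋ : ∀ {c c′} → c ≋ c′ → ∀ x → gap c x ≡ gap c′ x
  gap-≋ c≋c′ x = cong₂ _-_ (c≋c′ x) (c≋c′ (x + 1ℤ))

  ≋-sym : ∀ {c c′ : CylPart k n} → c ≋ c′ → c′ ≋ c
  ≋-sym c≋c′ x = sym (c≋c′ x)

  ≋-trans : ∀ {c c′ c″ : CylPart k n} → c ≋ c′ → c′ ≋ c″ → c ≋ c″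
  ≋-trans c≋c′ c′≋c″ x = trans (c≋c′ x) (c′≋c″ x)

  ≋⇒⊆ : ∀ {c c′ : CylPart k n} → c ≋ c′ → c ⊆ c′
  ≋⇒⊆ c≋c′ x = ℤP.≤-reflexive (c≋c′ x)

  ⊆-refl : ∀ {c : CylPart k n} → c ⊆ c
  ⊆-refl x = ℤP.≤-refl

  ⊆-trans : ∀ {c c′ c″ : CylPart k n} → c ⊆ c′ → c′ ⊆ c″ → c ⊆ c″
  ⊆-trans c⊆c′ c′⊆c″ x = ℤP.≤-trans (c⊆c′ x) (c′⊆c″ x)

  rfin : ℤ → Fin k
  rfin x = F.fromℕ< (res<k x)

  toℕ-rfin : ∀ x → toℕ (rfin x) ≡ res x
  toℕ-rfin x = FP.toℕ-fromℕ< (res<k x)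

  part-rfin : ∀ (c : CylPart k n) x → part c x ≡ part c (ρ (rfin x)) - quo x * w
  part-rfin c x = begin
    part c x                           ≡⟨ cong (part c) (res+quo x) ⟩
    part c (+ res x + quo x * K)       ≡⟨ cong (λ r → part c (+ r + quo x * K)) (sym (toℕ-rfin x)) ⟩
    part c (ρ (rfin x) + quo x * K)    ≡⟨ part-shift c (quo x) (ρ (rfin x)) ⟩
    part c (ρ (rfin x)) - quo x * w    ∎
    where open ≡-Reasoning

  ≋-fromFin : ∀ (c c′ : CylPart k n) → (∀ r → part c (ρ r) ≡ part c′ (ρ r)) → c ≋ c′
  ≋-fromFin c c′ eq x = trans (part-rfin c x) (trans (cong (_- quo x * w) (eq (rfin x))) (sym (part-rfin c′ x)))

  ⊆-fromFin : ∀ (c c′ : CylPart k n) → (∀ r → part c (ρ r) ℤ.≤ part c′ (ρ r)) → c ⊆ c′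
  ⊆-fromFin c c′ le x = subst₂ ℤ._≤_ (sym (part-rfin c x)) (sym (part-rfin c′ x)) (ℤP.+-monoˡ-≤ (- (quo x * w)) (le (rfin x)))

  _≋?_ : ∀ (c c′ : CylPart k n) → Dec (c ≋ c′)
  c ≋? c′ = map′ (≋-fromFin c c′) (λ c≋c′ r → c≋c′ (ρ r)) (FP.all? (λ r → part c (ρ r) ℤ.≟ part c′ (ρ r)))

  _⊆?_ : ∀ (c c′ : CylPart k n) → Dec (c ⊆ c′)
  c ⊆? c′ = map′ (⊆-fromFin c c′) (λ c⊆c′ r → c⊆c′ (ρ r)) (FP.all? (λ r → part c (ρ r) ℤ.≤? part c′ (ρ r)))

  part-difference-res : ∀ (c c′ : CylPart k n) x z → res x ≡ res z → part c z - part c′ z ≡ part c x - part c′ x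
  part-difference-res c c′ x z x≡z = begin
    part c z - part c′ z                                   ≡⟨ cong (λ u → part c u - part c′ u) (res-≡⇒shift x z x≡z) ⟩
    part c (x + Q * K) - part c′ (x + Q * K)               ≡⟨ cong₂ _-_ (part-shift c Q x) (part-shift c′ Q x) ⟩
    (part c x - Q * w) - (part c′ x - Q * w)               ≡⟨ [i-k]-[j-k]≡i-j (part c x) (part c′ x) (Q * w) ⟩
    part c x - part c′ x                                   ∎
    where
    open ≡-Reasoning
    Q = quo z - quo x

  -- The commutation relation DU = UD

  data Dir : Set where
    up down : Dir

  Movable : Dir → CylPart k n → Fin k → Set
  Movable up   = Addable
  Movable down = Removable

  Movable? : ∀ d c r → Dec (Movable d c r)
  Movable? up   = Addable?
  Movable? down = Removable?

  move : ∀ d c r → Movable d c r → CylPart k n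
  move up   = add
  move down = rem

  Movable-≋ : ∀ d {c c′} r → c ≋ c′ → Movable d c r → Movable d c′ r
  Movable-≋ up   {c} {c′} r c≋c′ = subst (0ℤ ℤ.<_) (gap-≋ {c} {c′} c≋c′ _)
  Movable-≋ down {c} {c′} r c≋c′ = subst (0ℤ ℤ.<_) (gap-≋ {c} {c′} c≋c′ _)

  move-≋ : ∀ d {c c′} r e e′ → c ≋ c′ → move d c r e ≋ move d c′ r e′
  move-≋ up   r e e′ c≋c′ x = cong (_+ δ r x) (c≋c′ x)
  move-≋ down r e e′ c≋c′ x = cong (_- δ r x) (c≋c′ x)

  Invariant : (CylPart k n → ℕ) → Set
  Invariant h = ∀ c c′ → c ≋ c′ → h c ≡ h c′

  -- step up and step down are the operators U and D, acting on functions of partitions.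
  step : Dir → (CylPart k n → ℕ) → CylPart k n → ℕ
  step d h c = sum (λ r → given (Movable? d c r) (λ e → h (move d c r e)))

  step-cong : ∀ d {h h′} → (∀ c → h c ≡ h′ c) → ∀ c → step d h c ≡ step d h′ c
  step-cong d h≡h′ c = sum-cong-≗ (λ r → given-cong (Movable? d c r) (λ e → h≡h′ (move d c r e)))

  step-invariant : ∀ d {h} → Invariant h → Invariant (step d h)
  step-invariant d inv c c′ c≋c′ = sum-cong-≗ λ r →
    given-↔ (Movable? d c r) (Movable? d c′ r) (Movable-≋ d {c} {c′} r c≋c′) (Movable-≋ d {c′} {c} r (≋-sym {c} {c′} c≋c′)) _ _
            (λ e e′ → inv (move d c r e) (move d c′ r e′) (move-≋ d {c} {c′} r e e′ c≋c′))

  step-sum : ∀ d {m} (φ : Fin m → CylPart k n → ℕ) c → step d (λ c′ → sum (λ i → φ i c′)) c ≡ sum (λ i → step d (φ i) c)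
  step-sum d φ c = trans (sum-cong-≗ (λ r → given-sum (Movable? d c r) (λ e i → φ i (move d c r e))))
                           (∑-comm (λ r i → given (Movable? d c r) (λ e → φ i (move d c r e))))

  step-given : ∀ d {A : Set} (dA : Dec A) (ψ : A → CylPart k n → ℕ) c →
               step d (λ c′ → given dA (λ a → ψ a c′)) c ≡ given dA (λ a → step d (ψ a) c)
  step-given d dA ψ c = trans (sum-cong-≗ (λ r → given-comm (Movable? d c r) dA (λ e a → ψ a (move d c r e))))
                              (sym (given-sum dA (λ a r → given (Movable? d c r) (λ e → ψ a (move d c r e)))))

  step-*ʳ : ∀ d h x c → step d h c ℕ.* x ≡ step d (λ c′ → h c′ ℕ.* x) c
  step-*ʳ d h x c = trans (*-distribʳ-sum x (λ r → given (Movable? d c r) (λ e → h (move d c r e))))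
                          (sum-cong-≗ (λ r → given-*ʳ (Movable? d c r) (λ e → h (move d c r e)) x))

  module _ (c : CylPart k n) (r s : Fin k) (r≢s : r ≢ s) where

    private
      d = δ r (ρ s + 1ℤ)

      gap-add-other : ∀ a → gap (add c r a) (ρ s) ≡ gap c (ρ s) - d
      gap-add-other a = begin
        gap (add c r a) (ρ s)              ≡⟨ gap-add c r a (ρ s) ⟩
        gap c (ρ s) + δ r (ρ s) - d        ≡⟨ cong (λ z → gap c (ρ s) + z - d) (δ-other r s r≢s) ⟩
        gap c (ρ s) + 0ℤ - d               ≡⟨ cong (_- d) (ℤP.+-identityʳ (gap c (ρ s))) ⟩
        gap c (ρ s) - d                    ∎
        where open ≡-Reasoning

      gap-rem-other : ∀ q → gap (rem c s q) (ρ r - 1ℤ) ≡ gap c (ρ r - 1ℤ) - d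
      gap-rem-other q = begin
        gap (rem c s q) (ρ r - 1ℤ)                                ≡⟨ gap-rem c s q (ρ r - 1ℤ) ⟩
        gap c (ρ r - 1ℤ) - δ s (ρ r - 1ℤ) + δ s (ρ r - 1ℤ + 1ℤ)   ≡⟨ cong₂ (λ u v → gap c (ρ r - 1ℤ) - u + δ s v) (sym (δ-swap r s)) (i-j+j≡i (ρ r) 1ℤ) ⟩
        gap c (ρ r - 1ℤ) - d + δ s (ρ r)                          ≡⟨ cong (λ z → gap c (ρ r - 1ℤ) - d + z) (δ-other s r (λ s≡r → r≢s (sym s≡r))) ⟩
        gap c (ρ r - 1ℤ) - d + 0ℤ                                 ≡⟨ ℤP.+-identityʳ (gap c (ρ r - 1ℤ) - d) ⟩
        gap c (ρ r - 1ℤ) - d                                      ∎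
        where open ≡-Reasoning

      -- d = 1 exactly when the rows of class r lie right below those of class s; then the two gaps involved coincide.
      d-cases : d ≡ 0ℤ ⊎ (d ≡ 1ℤ × gap c (ρ r - 1ℤ) ≡ gap c (ρ s))
      d-cases with χ-cases (res (ρ s + 1ℤ) ℕ.≟ toℕ r)
      ... | inj₂ d≡0        = inj₁ d≡0
      ... | inj₁ (eq , d≡1) = inj₂ (d≡1 , sym (gap-res c (ρ s) (ρ r - 1ℤ) (res-pred r (ρ s) eq)))

      d-cases′ : d ≡ 0ℤ ⊎ (d ≡ 1ℤ × gap c (ρ s) ≡ gap c (ρ r - 1ℤ))
      d-cases′ with d-cases
      ... | inj₁ d≡0         = inj₁ d≡0
      ... | inj₂ (d≡1 , eq) = inj₂ (d≡1 , sym eq)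

    add-then-remove : ∀ a → Removable (add c r a) s → Σ (Removable c s) λ q → Addable (rem c s q) r
    add-then-remove a q′ = proj₁ exchanged , subst (0ℤ ℤ.<_) (sym (gap-rem-other (proj₁ exchanged))) (proj₂ exchanged)
      where
      exchanged = 0<-exchange {gap c (ρ r - 1ℤ)} {gap c (ρ s)} {d} d-cases a (subst (0ℤ ℤ.<_) (gap-add-other a) q′)

    remove-then-add : ∀ q → Addable (rem c s q) r → Σ (Addable c r) λ a → Removable (add c r a) s
    remove-then-add q a′ = proj₁ exchanged , subst (0ℤ ℤ.<_) (sym (gap-add-other (proj₁ exchanged))) (proj₂ exchanged)
      where
      exchanged = 0<-exchange {gap c (ρ s)} {gap c (ρ r - 1ℤ)} {d} d-cases′ q (subst (0ℤ ℤ.<_) (gap-rem-other q) a′)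

  rem-add-comm : ∀ c r s a q a′ q′ → rem (add c r a) s q′ ≋ add (rem c s q) r a′
  rem-add-comm c r s a q a′ q′ x = xy∙z≈xz∙y (part c x) (δ r x) (- δ s x)

  corner-count : ∀ c → sum (λ r → indicator (Addable? c r)) ≡ sum (λ r → indicator (Removable? c r))
  corner-count c = begin
    sum (λ r → a (ρ r - 1ℤ))                               ≡⟨⟩
    a (- 1ℤ) ℕ.+ sum (λ r → a (ρ (F.suc r) - 1ℤ))          ≡⟨ cong₂ ℕ._+_ a-1≡a-k′ (sum-cong-≗ (λ r → cong a (ρ-suc r))) ⟩
    a (+ k′) ℕ.+ sum (λ r → a (ρ (F.inject₁ r)))           ≡⟨ ℕP.+-comm (a (+ k′)) _ ⟩
    sum (λ r → a (ρ (F.inject₁ r))) ℕ.+ a (+ k′)           ≡⟨ cong (λ z → sum (λ r → a (ρ (F.inject₁ r))) ℕ.+ a (+ z)) (sym (FP.toℕ-fromℕ k′)) ⟩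
    sum (λ r → a (ρ (F.inject₁ r))) ℕ.+ a (ρ (F.fromℕ k′)) ≡⟨ sym (sum-init-last (λ r → a (ρ r))) ⟩
    sum (λ r → a (ρ r))                                    ∎
    where
    open ≡-Reasoning
    a : ℤ → ℕ
    a x = indicator (0ℤ ℤ.<? gap c x)
    a-1≡a-k′ : a (- 1ℤ) ≡ a (+ k′)
    a-1≡a-k′ = cong (λ g → indicator (0ℤ ℤ.<? g))
                    (trans (sym (gap-shift c 1ℤ (- 1ℤ))) (cong (λ z → gap c (- 1ℤ + z)) (ℤP.*-identityˡ K)))
    ρ-suc : ∀ (r : Fin k′) → ρ (F.suc r) - 1ℤ ≡ ρ (F.inject₁ r)
    ρ-suc r = trans (ℤP.[+m]-[+n]≡m⊖n (suc (toℕ r)) 1) (cong +_ (sym (FP.toℕ-inject₁ r)))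

  diagonal : (Fin k → ℕ) → Fin k → Fin k → ℕ
  diagonal v r s = given (s FP.≟ r) (λ _ → v r)

  sum-diagonal : ∀ v r → sum (diagonal v r) ≡ v r
  sum-diagonal v r = trans (sum-single (diagonal v r) r off) on
    where
    off : ∀ s → s ≢ r → diagonal v r s ≡ 0
    off s s≢r = given-no (s FP.≟ r) (λ _ → v r) s≢r
    on : diagonal v r r ≡ v r
    on with r FP.≟ r
    ... | yes _   = refl
    ... | no r≢r  = ⊥-elim (r≢r refl)

  sum-sum-+-diagonal : ∀ (F : Fin k → Fin k → ℕ) v →
                       sum (λ r → sum (λ s → F r s ℕ.+ diagonal v r s)) ≡ sum (λ r → sum (F r)) ℕ.+ sum v
  sum-sum-+-diagonal F v = begin
    sum (λ r → sum (λ s → F r s ℕ.+ diagonal v r s))      ≡⟨ sum-cong-≗ (λ r → ∑-distrib-+ (F r) (diagonal v r)) ⟩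
    sum (λ r → sum (F r) ℕ.+ sum (diagonal v r))          ≡⟨ sum-cong-≗ (λ r → cong (sum (F r) ℕ.+_) (sum-diagonal v r)) ⟩
    sum (λ r → sum (F r) ℕ.+ v r)                         ≡⟨ ∑-distrib-+ (λ r → sum (F r)) v ⟩
    sum (λ r → sum (F r)) ℕ.+ sum v                       ∎
    where open ≡-Reasoning

  module _ {h : CylPart k n → ℕ} (inv : Invariant h) (c : CylPart k n) where

    private
      up-down down-up : Fin k → Fin k → ℕ
      up-down r s = given (Addable? c r) λ a → given (Removable? (add c r a) s) λ q → h (rem (add c r a) s q)
      down-up s r = given (Removable? c s) λ q → given (Addable? (rem c s q) r) λ a → h (add (rem c s q) r a)

      A R : Fin k → ℕ
      A r = indicator (Addable? c r) ℕ.* h c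
      R r = indicator (Removable? c r) ℕ.* h c

      indicator-* : ∀ {P : Set} (d : Dec P) → given d (λ _ → h c) ≡ indicator d ℕ.* h c
      indicator-* d = trans (given-cong d (λ _ → sym (ℕP.*-identityˡ (h c)))) (sym (given-*ʳ d (λ _ → 1) (h c)))

      up-down-diagonal : ∀ r → up-down r r ≡ A r
      up-down-diagonal r = trans (given-cong (Addable? c r) λ a →
          trans (given-yes (Removable? (add c r a) r) _ ℤP.<-irrelevant (add-Removable c r a))
                (inv (rem (add c r a) r (add-Removable c r a)) c (rem-add-≋ c r a (add-Removable c r a))))
        (indicator-* (Addable? c r))

      down-up-diagonal : ∀ r → down-up r r ≡ R r
      down-up-diagonal r = trans (given-cong (Removable? c r) λ q →
          trans (given-yes (Addable? (rem c r q) r) _ ℤP.<-irrelevant (rem-Addable c r q))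
                (inv (add (rem c r q) r (rem-Addable c r q)) c (add-rem-≋ c r q (rem-Addable c r q))))
        (indicator-* (Removable? c r))

      up-down-off-diagonal : ∀ r s → r ≢ s → up-down r s ≡ down-up s r
      up-down-off-diagonal r s r≢s =
        given²-↔ ℤP.<-irrelevant ℤP.<-irrelevant (Addable? c r) (λ a → Removable? (add c r a) s)
                 (Removable? c s) (λ q → Addable? (rem c s q) r) _ _
                 (add-then-remove c r s r≢s) (remove-then-add c r s r≢s)
                 (λ a q′ q a′ → inv (rem (add c r a) s q′) (add (rem c s q) r a′) (rem-add-comm c r s a q a′ q′))

      balance : ∀ r s → up-down r s ℕ.+ diagonal R r s ≡ down-up s r ℕ.+ diagonal A r s
      balance r s = by-cases (s FP.≟ r)
        where
        by-cases : (s≟r : Dec (s ≡ r)) → up-down r s ℕ.+ given s≟r (λ _ → R r) ≡ down-up s r ℕ.+ given s≟r (λ _ → A r)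
        by-cases (no s≢r)  = cong (ℕ._+ 0) (up-down-off-diagonal r s (λ r≡s → s≢r (sym r≡s)))
        by-cases (yes refl) = begin
          up-down r r ℕ.+ R r   ≡⟨ cong (ℕ._+ R r) (up-down-diagonal r) ⟩
          A r ℕ.+ R r           ≡⟨ ℕP.+-comm (A r) (R r) ⟩
          R r ℕ.+ A r           ≡⟨ cong (ℕ._+ A r) (sym (down-up-diagonal r)) ⟩
          down-up r r ℕ.+ A r   ∎
          where open ≡-Reasoning

      up-down-sum : step up (step down h) c ≡ sum (λ r → sum (up-down r))
      up-down-sum = sum-cong-≗ λ r →
        given-sum (Addable? c r) (λ a s → given (Removable? (add c r a) s) λ q → h (rem (add c r a) s q))

      down-up-sum : step down (step up h) c ≡ sum (λ s → sum (down-up s))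
      down-up-sum = sum-cong-≗ λ s →
        given-sum (Removable? c s) (λ q r → given (Addable? (rem c s q) r) λ a → h (add (rem c s q) r a))

      sum-A≡sum-R : sum A ≡ sum R
      sum-A≡sum-R = begin
        sum A                                          ≡⟨ sym (*-distribʳ-sum (h c) (λ r → indicator (Addable? c r))) ⟩
        sum (λ r → indicator (Addable? c r)) ℕ.* h c   ≡⟨ cong (ℕ._* h c) (corner-count c) ⟩
        sum (λ r → indicator (Removable? c r)) ℕ.* h c ≡⟨ *-distribʳ-sum (h c) (λ r → indicator (Removable? c r)) ⟩
        sum R                                          ∎
        where open ≡-Reasoning

    -- DU = UD: the diagonal terms are matched by corner-count, the others by the exchange lemmas.
    up-down≡down-up : step up (step down h) c ≡ step down (step up h) c
    up-down≡down-up = ℕP.+-cancelʳ-≡ (sum R) _ _ (begin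
      step up (step down h) c ℕ.+ sum R                             ≡⟨ cong (ℕ._+ sum R) up-down-sum ⟩
      sum (λ r → sum (up-down r)) ℕ.+ sum R                         ≡⟨ sym (sum-sum-+-diagonal up-down R) ⟩
      sum (λ r → sum (λ s → up-down r s ℕ.+ diagonal R r s))        ≡⟨ sum-cong-≗ (λ r → sum-cong-≗ (balance r)) ⟩
      sum (λ r → sum (λ s → down-up s r ℕ.+ diagonal A r s))        ≡⟨ sum-sum-+-diagonal (λ r s → down-up s r) A ⟩
      sum (λ r → sum (λ s → down-up s r)) ℕ.+ sum A                 ≡⟨ cong₂ ℕ._+_ (∑-comm (λ r s → down-up s r)) sum-A≡sum-R ⟩
      sum (λ s → sum (down-up s)) ℕ.+ sum R                         ≡⟨ cong (ℕ._+ sum R) (sym down-up-sum) ⟩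
      step down (step up h) c ℕ.+ sum R                             ∎)
      where open ≡-Reasoning

  -- Iterated moves and paths

  steps : Dir → ℕ → (CylPart k n → ℕ) → CylPart k n → ℕ
  steps d zero    h = h
  steps d (suc m) h = step d (steps d m h)

  steps-cong : ∀ d m {h h′} → (∀ c → h c ≡ h′ c) → ∀ c → steps d m h c ≡ steps d m h′ c
  steps-cong d zero    h≡h′ = h≡h′
  steps-cong d (suc m) h≡h′ = step-cong d (steps-cong d m h≡h′)

  steps-invariant : ∀ d m {h} → Invariant h → Invariant (steps d m h)
  steps-invariant d zero    inv = inv
  steps-invariant d (suc m) inv = step-invariant d (steps-invariant d m inv)

  steps-sum : ∀ d m {p} (φ : Fin p → CylPart k n → ℕ) c →
              steps d m (λ c′ → sum (λ i → φ i c′)) c ≡ sum (λ i → steps d m (φ i) c)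
  steps-sum d zero    φ c = refl
  steps-sum d (suc m) φ c = trans (step-cong d (steps-sum d m φ) c) (step-sum d (λ i → steps d m (φ i)) c)

  steps-given : ∀ d m {A : Set} (dA : Dec A) (ψ : A → CylPart k n → ℕ) c →
                steps d m (λ c′ → given dA (λ a → ψ a c′)) c ≡ given dA (λ a → steps d m (ψ a) c)
  steps-given d zero    dA ψ c = refl
  steps-given d (suc m) dA ψ c = trans (step-cong d (steps-given d m dA ψ) c) (step-given d dA (λ a → steps d m (ψ a)) c)

  steps-*ʳ : ∀ d m h x c → steps d m h c ℕ.* x ≡ steps d m (λ c′ → h c′ ℕ.* x) c
  steps-*ʳ d zero    h x c = refl
  steps-*ʳ d (suc m) h x c = trans (step-*ʳ d (steps d m h) x c) (step-cong d (steps-*ʳ d m h x) c)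

  steps-suc : ∀ d m h c → steps d (suc m) h c ≡ steps d m (step d h) c
  steps-suc d zero    h c = refl
  steps-suc d (suc m) h c = step-cong d (steps-suc d m h) c

  down-steps-up : ∀ j {h} → Invariant h → ∀ c → step down (steps up j h) c ≡ steps up j (step down h) c
  down-steps-up zero    inv c = refl
  down-steps-up (suc j) inv c =
    trans (sym (up-down≡down-up (steps-invariant up j inv) c)) (step-cong up (down-steps-up j inv) c)

  steps-down-up : ∀ m j {h} → Invariant h → ∀ c → steps down m (steps up j h) c ≡ steps up j (steps down m h) c
  steps-down-up zero    j inv c = refl
  steps-down-up (suc m) j inv c =
    trans (step-cong down (steps-down-up m j inv) c) (down-steps-up j (steps-invariant down m inv) c)

  at : CylPart k n → CylPart k n → ℕ
  at b c = indicator (c ≋? b)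

  at-invariant : ∀ b → Invariant (at b)
  at-invariant b c c′ c≋c′ =
    given-↔ (c ≋? b) (c′ ≋? b) (≋-trans {c′} {c} {b} (≋-sym {c} {c′} c≋c′)) (≋-trans {c} {c′} {b} c≋c′) (λ _ → 1) (λ _ → 1) (λ _ _ → refl)

  -- paths d m a b counts the ways to go from a to b by m single-box moves in direction d.
  paths : Dir → ℕ → CylPart k n → CylPart k n → ℕ
  paths d m a b = steps d m (at b) a

  step-down-at : ∀ b c → step down (at b) c ≡ sum (λ s → given (Addable? b s) (λ a → at (add b s a) c))
  step-down-at b c = sum-cong-≗ λ s →
    given²-↔ ℤP.<-irrelevant ℤP.<-irrelevant (Removable? c s) (λ q → rem c s q ≋? b) (Addable? b s) (λ a → c ≋? add b s a)
             (λ _ _ → 1) (λ _ _ → 1) (to s) (from s) (λ _ _ _ _ → refl)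
    where
    to : ∀ s q → rem c s q ≋ b → Σ (Addable b s) λ a → c ≋ add b s a
    to s q rem≋b = a , λ x → trans (sym (add-rem-≋ c s q (rem-Addable c s q) x)) (cong (_+ δ s x) (rem≋b x))
      where a = subst (0ℤ ℤ.<_) (gap-≋ {rem c s q} {b} rem≋b (ρ s - 1ℤ)) (rem-Addable c s q)
    from : ∀ s a → c ≋ add b s a → Σ (Removable c s) λ q → rem c s q ≋ b
    from s a c≋add = q , λ x → trans (cong (_- δ s x) (c≋add x)) (rem-add-≋ b s a (add-Removable b s a) x)
      where q = subst (0ℤ ℤ.<_) (sym (gap-≋ {c} {add b s a} c≋add (ρ s))) (add-Removable b s a)

  paths-reverse : ∀ m a b → paths down m a b ≡ paths up m b a
  paths-reverse zero a b = given-↔ (a ≋? b) (b ≋? a) (≋-sym {a} {b}) (≋-sym {b} {a}) (λ _ → 1) (λ _ → 1) (λ _ _ → refl)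
  paths-reverse (suc m) a b = begin
    steps down (suc m) (at b) a
      ≡⟨ steps-suc down m (at b) a ⟩
    steps down m (step down (at b)) a
      ≡⟨ steps-cong down m (step-down-at b) a ⟩
    steps down m (λ c → sum (λ s → φ s c)) a
      ≡⟨ steps-sum down m φ a ⟩
    sum (λ s → steps down m (φ s) a)
      ≡⟨ sum-cong-≗ (λ s → steps-given down m (Addable? b s) (λ e c → at (add b s e) c) a) ⟩
    sum (λ s → given (Addable? b s) (λ e → paths down m a (add b s e)))
      ≡⟨ sum-cong-≗ (λ s → given-cong (Addable? b s) (λ e → paths-reverse m a (add b s e))) ⟩
    paths up (suc m) b a
      ∎
    where
    open ≡-Reasoning
    φ : Fin k → CylPart k n → ℕ
    φ s c = given (Addable? b s) (λ e → at (add b s e) c)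

  Reach : Dir → ℕ → CylPart k n → CylPart k n → Set
  Reach d zero    a c = a ≡ c
  Reach d (suc m) a c = Σ (Fin k) λ r → Σ (Movable d a r) λ e → Reach d m (move d a r e) c

  steps-cong-reach : ∀ d m a {h h′} → (∀ c → Reach d m a c → h c ≡ h′ c) → steps d m h a ≡ steps d m h′ a
  steps-cong-reach d zero    a h≡h′ = h≡h′ a refl
  steps-cong-reach d (suc m) a h≡h′ = sum-cong-≗ λ r → given-cong (Movable? d a r) λ e →
    steps-cong-reach d m (move d a r e) (λ c reach → h≡h′ c (r , e , reach))

  steps≢0⇒reach : ∀ d m a h → steps d m h a ≢ 0 → Σ (CylPart k n) λ c → Reach d m a c × h c ≢ 0
  steps≢0⇒reach d zero    a h ≢0 = a , refl , ≢0
  steps≢0⇒reach d (suc m) a h ≢0 with sum≢0⇒∃≢0 _ ≢0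
  ... | r , ≢0′ with given≢0⇒∃≢0 (Movable? d a r) _ ≢0′
  ...   | e , ≢0″ with steps≢0⇒reach d m (move d a r e) h ≢0″
  ...     | c , reach , hc≢0 = c , (r , e , reach) , hc≢0

  paths-down≢0⇒reach : ∀ m a b → paths down m a b ≢ 0 → Σ (CylPart k n) λ c → Reach down m a c × c ≋ b
  paths-down≢0⇒reach m a b ≢0 with steps≢0⇒reach down m a (at b) ≢0
  ... | c , reach , at≢0 = c , reach , proj₁ (given≢0⇒∃≢0 (c ≋? b) _ at≢0)

  Reach-down-⊆ : ∀ m a c → Reach down m a c → c ⊆ a
  Reach-down-⊆ zero    a c refl           = ⊆-refl {a}
  Reach-down-⊆ (suc m) a c (r , q , reach) = ⊆-trans {c} {rem a r q} {a} (Reach-down-⊆ m (rem a r q) c reach) (rem-⊆ a r q)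

  Reach-up-⊇ : ∀ m a c → Reach up m a c → a ⊆ c
  Reach-up-⊇ zero    a c refl           = ⊆-refl {a}
  Reach-up-⊇ (suc m) a c (r , e , reach) = ⊆-trans {a} {add a r e} {c} (add-⊇ a r e) (Reach-up-⊇ m (add a r e) c reach)

  -- Sizes are only defined up to a constant: the sum over one period of parts.
  size : CylPart k n → ℤ
  size c = ℤΣ.sum (λ r → part c (ρ r))

  size-≋ : ∀ {c c′} → c ≋ c′ → size c ≡ size c′
  size-≋ c≋c′ = ℤΣ.sum-cong-≗ (λ r → c≋c′ (ρ r))

  size-mono : ∀ {c c′} → c ⊆ c′ → size c ℤ.≤ size c′
  size-mono c⊆c′ = sum-mono-≤ (λ r → c⊆c′ (ρ r))
    where
    sum-mono-≤ : ∀ {m} {f g : Fin m → ℤ} → (∀ i → f i ℤ.≤ g i) → ℤΣ.sum f ℤ.≤ ℤΣ.sum g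
    sum-mono-≤ {zero}  f≤g = ℤP.≤-refl
    sum-mono-≤ {suc m} f≤g = ℤP.+-mono-≤ (f≤g F.zero) (sum-mono-≤ (λ i → f≤g (F.suc i)))

  size-add : ∀ c r a → size (add c r a) ≡ size c + 1ℤ
  size-add c r a = trans (ℤΣ.∑-distrib-+ (λ s → part c (ρ s)) (λ s → δ r (ρ s))) (cong (λ z → size c + z) sum-δ)
    where
    sum-δ : ℤΣ.sum (λ s → δ r (ρ s)) ≡ 1ℤ
    sum-δ = begin
      ℤΣ.sum (λ s → δ r (ρ s))                                 ≡⟨ ℤΣ.sum-remove {k′} {r} (λ s → δ r (ρ s)) ⟩
      δ r (ρ r) + ℤΣ.sum (λ i → δ r (ρ (F.punchIn r i)))       ≡⟨ cong₂ _+_ (δ-self r) (ℤΣ.sum-cong-≗ off-r) ⟩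
      1ℤ + ℤΣ.sum {k′} (λ _ → 0ℤ)                                 ≡⟨ cong (λ z → 1ℤ + z) (ℤΣ.sum-replicate-zero k′) ⟩
      1ℤ                                                       ∎
      where
      open ≡-Reasoning
      off-r : ∀ i → δ r (ρ (F.punchIn r i)) ≡ 0ℤ
      off-r i = δ-other r (F.punchIn r i) (λ eq → FP.punchInᵢ≢i r i (sym eq))

  size-rem : ∀ c r q → size c ≡ size (rem c r q) + 1ℤ
  size-rem c r q = trans (size-≋ {c} {add (rem c r q) r a} (≋-sym {add (rem c r q) r a} {c} (add-rem-≋ c r q a))) (size-add (rem c r q) r a)
    where a = rem-Addable c r q

  Reach-down-size : ∀ m a c → Reach down m a c → size a ≡ size c + + m
  Reach-down-size zero    a c refl            = sym (ℤP.+-identityʳ (size a))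
  Reach-down-size (suc m) a c (r , q , reach) = begin
    size a                     ≡⟨ size-rem a r q ⟩
    size (rem a r q) + 1ℤ      ≡⟨ cong (_+ 1ℤ) (Reach-down-size m (rem a r q) c reach) ⟩
    size c + + m + 1ℤ          ≡⟨ ℤP.+-assoc (size c) (+ m) 1ℤ ⟩
    size c + (+ m + 1ℤ)        ≡⟨ cong (λ z → size c + z) (ℤP.+-comm (+ m) 1ℤ) ⟩
    size c + + suc m           ∎
    where open ≡-Reasoning

  paths-down≢0⇒size : ∀ m a b → paths down m a b ≢ 0 → size a ≡ size b + + m
  paths-down≢0⇒size m a b ≢0 =
    let c , reach , c≋b = paths-down≢0⇒reach m a b ≢0
    in trans (Reach-down-size m a c reach) (cong (_+ + m) (size-≋ {c} {b} c≋b))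

  paths-down≢0⇒⊆ : ∀ m a b → paths down m a b ≢ 0 → b ⊆ a
  paths-down≢0⇒⊆ m a b ≢0 =
    let c , reach , c≋b = paths-down≢0⇒reach m a b ≢0
    in ⊆-trans {b} {c} {a} (≋⇒⊆ {b} {c} (≋-sym {c} {b} c≋b)) (Reach-down-⊆ m a c reach)

  paths-down-vanish-⊆ : ∀ m a b → ¬ b ⊆ a → paths down m a b ≡ 0
  paths-down-vanish-⊆ m a b b⊈a = decidable-stable (paths down m a b ℕ.≟ 0) (λ ≢0 → b⊈a (paths-down≢0⇒⊆ m a b ≢0))

  paths-down-vanish-size : ∀ m a b → size a ≢ size b + + m → paths down m a b ≡ 0
  paths-down-vanish-size m a b size≢ = decidable-stable (paths down m a b ℕ.≟ 0) (λ ≢0 → size≢ (paths-down≢0⇒size m a b ≢0))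

  -- Boxes of skew shapes

  _∼_ : Point → Point → Set
  _∼_ = SameBox k n

  ∼-sym : ∀ {b b′} → b ∼ b′ → b′ ∼ b
  ∼-sym {x , y} (t , refl , refl) = - t , there-and-back x t (- K) , there-and-back y t w
    where
    there-and-back : ∀ x t m → x ≡ x + t * m + (- t) * m
    there-and-back = solve-∀

  ∼-trans : ∀ {b b′ b″} → b ∼ b′ → b′ ∼ b″ → b ∼ b″
  ∼-trans {x , y} (t , refl , refl) (t′ , refl , refl) = t + t′ , combine x t t′ (- K) , combine y t t′ w
    where
    combine : ∀ x t t′ m → x + t * m + t′ * m ≡ x + (t + t′) * m
    combine = solve-∀

  ∼-next : ∀ x y → (x , y) ∼ (x - K , y + w)
  ∼-next x y = 1ℤ , once x (- K) , once y w
    where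
    once : ∀ x m → x + m ≡ x + 1ℤ * m
    once = solve-∀

  ∼⇒res : ∀ {x y x′ y′} → (x , y) ∼ (x′ , y′) → res x ≡ res x′
  ∼⇒res {x} (t , refl , refl) = trans (sym (res-shift x (- t))) (cong res (neg-swap x t K))
    where
    neg-swap : ∀ x t m → x + (- t) * m ≡ x + t * (- m)
    neg-swap = solve-∀

  part-shift′ : ∀ (c : CylPart k n) x t → part c (x + t * (- K)) ≡ part c x + t * w
  part-shift′ c x t = trans (cong (part c) (neg-swap x t K)) (trans (part-shift c (- t) x) (neg-swap′ (part c x) t w))
    where
    neg-swap : ∀ x t m → x + t * (- m) ≡ x + (- t) * m
    neg-swap = solve-∀
    neg-swap′ : ∀ p t m → p - (- t) * m ≡ p + t * m
    neg-swap′ = solve-∀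

  InPart-∼ : ∀ (c : CylPart k n) {b b′} → InPart c b → b ∼ b′ → InPart c b′
  InPart-∼ c {x , y} b∈c (t , refl , refl) =
    subst (y + t * w ℤ.≤_) (sym (part-shift′ c x t)) (ℤP.+-monoˡ-≤ (t * w) b∈c)

  InSkew-∼ : ∀ (lam mu : CylPart k n) {b b′} → InSkew lam mu b → b ∼ b′ → InSkew lam mu b′
  InSkew-∼ lam mu (b∈lam , b∉mu) b∼b′ = InPart-∼ lam b∈lam b∼b′ , λ b′∈mu → b∉mu (InPart-∼ mu b′∈mu (∼-sym b∼b′))

  ∼-same-row : ∀ {x y y′} → (x , y) ∼ (x , y′) → y ≡ y′
  ∼-same-row {x} {y} (t , x≡ , refl) with ℤP.*-cancelʳ-≡ t 0ℤ (- K) (i≡i+j⇒j≡0 x≡)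
  ... | refl = sym (ℤP.+-identityʳ y)

  InPart-mono : ∀ {c c′ : CylPart k n} {b} → c ⊆ c′ → InPart c b → InPart c′ b
  InPart-mono {b = x , y} c⊆c′ b∈c = ℤP.≤-trans b∈c (c⊆c′ x)

  InSkew-mono : ∀ {lam lam′ mu : CylPart k n} {b} → lam ⊆ lam′ → InSkew lam mu b → InSkew lam′ mu b
  InSkew-mono {lam} {lam′} {b = b} lam⊆lam′ (b∈lam , b∉mu) = InPart-mono {lam} {lam′} {b} lam⊆lam′ b∈lam , b∉mu

  part-antitone : ∀ (c : CylPart k n) {x x′} → x ℤ.≤ x′ → part c x′ ℤ.≤ part c x
  part-antitone c {x} x≤x′ with ≤⇒≡+ℕ x≤x′
  ... | d , refl = go d
    where
    go : ∀ d → part c (x + + d) ℤ.≤ part c x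
    go zero    = ℤP.≤-reflexive (cong (part c) (ℤP.+-identityʳ x))
    go (suc d) = ℤP.≤-trans (subst (λ z → part c z ℤ.≤ part c (x + + d)) x+d+1≡ (decreasing c (x + + d))) (go d)
      where
      x+d+1≡ : x + + d + 1ℤ ≡ x + + suc d
      x+d+1≡ = trans (ℤP.+-assoc x (+ d) 1ℤ) (cong (λ z → x + z) (ℤP.+-comm (+ d) 1ℤ))

  module SYT (lam mu : CylPart k n) (T : Tableau) (t : IsSYT lam mu T) where

    shift-invariant : ∀ x y → InSkew lam mu (x , y) → T (x , y) ≡ T (x - K , y + w)
    shift-invariant = proj₁ t

    rows : ∀ x y y′ → y ℤ.< y′ → InSkew lam mu (x , y) → InSkew lam mu (x , y′) → T (x , y) ℕ.≤ T (x , y′)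
    rows = proj₁ (proj₂ t)

    columns : ∀ x x′ y → x ℤ.< x′ → InSkew lam mu (x , y) → InSkew lam mu (x′ , y) → T (x , y) ℕ.< T (x′ , y)
    columns = proj₁ (proj₂ (proj₂ t))

    max : ℕ
    max = proj₁ (proj₂ (proj₂ (proj₂ t)))

    bounds : ∀ b → InSkew lam mu b → (1 ℕ.≤ T b) × (T b ℕ.≤ max)
    bounds = proj₁ (proj₂ (proj₂ (proj₂ (proj₂ t))))

    injective : ∀ b b′ → InSkew lam mu b → InSkew lam mu b′ → T b ≡ T b′ → b ∼ b′
    injective = proj₁ (proj₂ (proj₂ (proj₂ (proj₂ (proj₂ t)))))

    surjective : ∀ j → 1 ℕ.≤ j → j ℕ.≤ max → Σ Point λ b → InSkew lam mu b × T b ≡ j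
    surjective = proj₂ (proj₂ (proj₂ (proj₂ (proj₂ (proj₂ t)))))

    private
      shiftℕ-invariant : ∀ m x y → InSkew lam mu (x , y) → T (x , y) ≡ T (x + + m * (- K) , y + + m * w)
      shiftℕ-invariant zero    x y b∈ = cong₂ (λ u v → T (u , v)) (sym (ℤP.+-identityʳ x)) (sym (ℤP.+-identityʳ y))
      shiftℕ-invariant (suc m) x y b∈ = trans (shiftℕ-invariant m x y b∈)
        (trans (shift-invariant _ _ (InSkew-∼ lam mu b∈ (+ m , refl , refl)))
               (cong₂ (λ u v → T (u , v)) (one-more x (+ m) (- K)) (one-more y (+ m) w)))
        where
        one-more : ∀ x M c → x + M * c + c ≡ x + (1ℤ + M) * c
        one-more = solve-∀

    box-invariant : ∀ {b b′} → InSkew lam mu b → b ∼ b′ → T b ≡ T b′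
    box-invariant {x , y} b∈ (+ m , refl , refl)      = shiftℕ-invariant m x y b∈
    box-invariant {x , y} b∈ (-[1+ m ] , refl , refl) =
      sym (trans (shiftℕ-invariant (suc m) _ _ (InSkew-∼ lam mu b∈ (-[1+ m ] , refl , refl)))
                 (cong₂ (λ u v → T (u , v)) (back x (+ suc m) (- K)) (back y (+ suc m) w)))
      where
      back : ∀ x M c → x + (- M) * c + M * c ≡ x
      back = solve-∀

  SYT-max-≤ : ∀ lam mu T T′ (t : IsSYT lam mu T) (t′ : IsSYT lam mu T′) →
              SameTableau lam mu T T′ → SYT.max lam mu T′ t′ ℕ.≤ SYT.max lam mu T t
  SYT-max-≤ lam mu T T′ t t′ T≡T′ with SYT.max lam mu T′ t′ | SYT.surjective lam mu T′ t′
  ... | zero  | _    = ℕ.z≤n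
  ... | suc p | surj with surj (suc p) (ℕ.s≤s ℕ.z≤n) ℕP.≤-refl
  ...   | b , b∈ , T′b≡ = subst (ℕ._≤ SYT.max lam mu T t) (trans (T≡T′ b b∈) T′b≡) (proj₂ (SYT.bounds lam mu T t b b∈))

  SYT-max-unique : ∀ lam mu T T′ (t : IsSYT lam mu T) (t′ : IsSYT lam mu T′) →
                   SameTableau lam mu T T′ → SYT.max lam mu T t ≡ SYT.max lam mu T′ t′
  SYT-max-unique lam mu T T′ t t′ T≡T′ =
    ℕP.≤-antisym (SYT-max-≤ lam mu T′ T t′ t (λ b b∈ → sym (T≡T′ b b∈))) (SYT-max-≤ lam mu T T′ t t′ T≡T′)

  -- λ/(λ - δ r) is the single box of the cylinder containing the corner (ρ r , λ_{ρ r}).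
  module Corner (lam : CylPart k n) (r : Fin k) (q : Removable lam r) where

    nu : CylPart k n
    nu = rem lam r q

    corner : Point
    corner = ρ r , part lam (ρ r)

    corner∈lam : InPart lam corner
    corner∈lam = ℤP.≤-refl

    corner∉nu : ¬ InPart nu corner
    corner∉nu corner∈nu = i≰i-1 (part lam (ρ r)) (subst (λ d → part lam (ρ r) ℤ.≤ part lam (ρ r) - d) (δ-self r) corner∈nu)

    corner-∼ : ∀ x → res x ≡ toℕ r → corner ∼ (x , part lam x)
    corner-∼ x res≡r = - quo x , trans x≡ (neg² (ρ r) (quo x) K) ,
                       trans (cong (part lam) x≡) (trans (part-shift lam (quo x) (ρ r)) (neg-sub (part lam (ρ r)) (quo x) w))
      where
      x≡ : x ≡ ρ r + quo x * K
      x≡ = trans (res+quo x) (cong (λ z → + z + quo x * K) res≡r)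
      neg² : ∀ a Q m → a + Q * m ≡ a + (- Q) * (- m)
      neg² = solve-∀
      neg-sub : ∀ a Q m → a - Q * m ≡ a + (- Q) * m
      neg-sub = solve-∀

    ∼corner⇒∉nu : ∀ {b} → corner ∼ b → ¬ InPart nu b
    ∼corner⇒∉nu corner∼b b∈nu = corner∉nu (InPart-∼ nu b∈nu (∼-sym corner∼b))

    lam∖nu⇒∼corner : ∀ {x y} → InPart lam (x , y) → ¬ InPart nu (x , y) → corner ∼ (x , y)
    lam∖nu⇒∼corner {x} {y} y≤ y≰ with χ-cases (res x ℕ.≟ toℕ r)
    ... | inj₂ δ≡0          = ⊥-elim (y≰ (subst (λ d → y ℤ.≤ part lam x - d) (sym δ≡0) (subst (y ℤ.≤_) (sym (ℤP.+-identityʳ (part lam x))) y≤)))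
    ... | inj₁ (res≡r , δ≡1) = subst (λ z → corner ∼ (x , z)) (sym y≡) (corner-∼ x res≡r)
      where
      y≡ : y ≡ part lam x
      y≡ = ≤∧≰i-1⇒≡ y≤ (λ y≤′ → y≰ (subst (λ d → y ℤ.≤ part lam x - d) (sym δ≡1) y≤′))

    ∼corner⇒ : ∀ {x y} → corner ∼ (x , y) → (y ≡ part lam x) × (res x ≡ toℕ r)
    ∼corner⇒ {x} {y} corner∼b@(t , refl , refl) = sym (part-shift′ lam (ρ r) t) , trans (sym (∼⇒res {ρ r} {part lam (ρ r)} {x} {y} corner∼b)) (res-ρ r)

    NumBoxes-extend : ∀ (c : CylPart k n) → c ⊆ nu → ∀ m → NumBoxes nu c m → NumBoxes lam c (suc m)
    NumBoxes-extend c c⊆nu m (e , E) = e′ , record { enum-in = e′-in ; enum-inj = e′-inj ; enum-surj = e′-surj }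
      where
      open IsEnum E
      nu⊆lam = rem-⊆ lam r q
      e′ : Fin (suc m) → Point
      e′ F.zero    = corner
      e′ (F.suc i) = e i
      e′-in : ∀ i → InSkew lam c (e′ i)
      e′-in F.zero    = corner∈lam , λ corner∈c → corner∉nu (InPart-mono {c} {nu} {corner} c⊆nu corner∈c)
      e′-in (F.suc i) = InSkew-mono {nu} {lam} {c} {e i} nu⊆lam (enum-in i)
      e′-inj : ∀ i j → e′ i ∼ e′ j → i ≡ j
      e′-inj F.zero    F.zero    _   = refl
      e′-inj F.zero    (F.suc j) e∼e = ⊥-elim (∼corner⇒∉nu e∼e (proj₁ (enum-in j)))
      e′-inj (F.suc i) F.zero    e∼e = ⊥-elim (∼corner⇒∉nu (∼-sym e∼e) (proj₁ (enum-in i)))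
      e′-inj (F.suc i) (F.suc j) e∼e = cong F.suc (enum-inj i j e∼e)
      e′-surj : ∀ b → InSkew lam c b → Σ (Fin (suc m)) λ i → e′ i ∼ b
      e′-surj (x , y) (b∈lam , b∉c) with y ℤ.≤? part nu x
      ... | yes b∈nu = let (i , ei∼b) = enum-surj (x , y) (b∈nu , b∉c) in F.suc i , ei∼b
      ... | no b∉nu  = F.zero , lam∖nu⇒∼corner b∈lam b∉nu

  NumBoxes-≋ : ∀ {lam lam′ mu mu′ : CylPart k n} {m} → lam ≋ lam′ → mu ≋ mu′ → NumBoxes lam mu m → NumBoxes lam′ mu′ m
  NumBoxes-≋ {lam} {lam′} {mu} {mu′} lam≋ mu≋ (e , E) = e , record
    { enum-in = λ i → transport (enum-in i) ; enum-inj = enum-inj ; enum-surj = λ b b∈ → enum-surj b (transport⁻ b∈) }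
    where
    open IsEnum E
    transport : ∀ {b} → InSkew lam mu b → InSkew lam′ mu′ b
    transport {x , y} (b∈ , b∉) = subst (y ℤ.≤_) (lam≋ x) b∈ , λ b∈′ → b∉ (subst (y ℤ.≤_) (sym (mu≋ x)) b∈′)
    transport⁻ : ∀ {b} → InSkew lam′ mu′ b → InSkew lam mu b
    transport⁻ {x , y} (b∈ , b∉) = subst (y ℤ.≤_) (sym (lam≋ x)) b∈ , λ b∈′ → b∉ (subst (y ℤ.≤_) (mu≋ x) b∈′)

  NumBoxes-unique : ∀ {lam mu : CylPart k n} {m m′} → NumBoxes lam mu m → NumBoxes lam mu m′ → m ≡ m′
  NumBoxes-unique (_ , E) (_ , E′) = enum-size-unique (λ {b} {b′} → ∼-sym {b} {b′}) (λ {b} {b′} {b″} → ∼-trans {b} {b′} {b″}) E E′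

  Reach-down-NumBoxes : ∀ m a c → Reach down m a c → NumBoxes a c m
  Reach-down-NumBoxes zero    a c refl            = (λ ()) , record { enum-in = λ () ; enum-inj = λ () ; enum-surj = λ b b∈ → ⊥-elim (proj₂ b∈ (proj₁ b∈)) }
  Reach-down-NumBoxes (suc m) a c (r , q , reach) =
    Corner.NumBoxes-extend a r q c (Reach-down-⊆ m (rem a r q) c reach) m (Reach-down-NumBoxes m (rem a r q) c reach)

  paths-down≢0⇒NumBoxes : ∀ m a b → paths down m a b ≢ 0 → NumBoxes a b m
  paths-down≢0⇒NumBoxes m a b ≢0 =
    let c , reach , c≋b = paths-down≢0⇒reach m a b ≢0
    in NumBoxes-≋ {a} {a} {c} {b} (λ _ → refl) c≋b (Reach-down-NumBoxes m a c reach)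

  -- Removing the largest entry of a standard tableau

  rfin-res : ∀ x x′ → res x ≡ res x′ → rfin x ≡ rfin x′
  rfin-res x x′ eq = FP.toℕ-injective (trans (toℕ-rfin x) (trans eq (sym (toℕ-rfin x′))))

  skew-nonempty : ∀ (lam mu : CylPart k n) → mu ⊆ lam → ¬ lam ≋ mu → Σ Point (InSkew lam mu)
  skew-nonempty lam mu mu⊆lam lam≉mu with FP.¬∀⟶∃¬ k _ (λ r → part lam (ρ r) ℤ.≟ part mu (ρ r)) (λ eq → lam≉mu (≋-fromFin lam mu eq))
  ... | r , λr≢μr = (ρ r , part lam (ρ r)) , ℤP.≤-refl , λ λr≤μr → λr≢μr (ℤP.≤-antisym λr≤μr (mu⊆lam (ρ r)))

  -- The largest entry of a standard tableau sits in a removable box of λ whose whole residue class lies outside μ.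
  module TopBox (lam mu : CylPart k n) (T : Tableau) (t : IsSYT lam mu T) {x y : ℤ}
                (b∈ : InSkew lam mu (x , y)) (Tb≡max : T (x , y) ≡ SYT.max lam mu T t) where
    open SYT lam mu T t

    at-row-end : y ≡ part lam x
    at-row-end = ≤∧≰i-1⇒≡ (proj₁ b∈) y≰
      where
      y≰ : ¬ (y ℤ.≤ part lam x - 1ℤ)
      y≰ y≤ = ℤP.<-irrefl y≡y+1 (i<i+1 y)
        where
        next∈ : InSkew lam mu (x , y + 1ℤ)
        next∈ = subst (y + 1ℤ ℤ.≤_) (i-j+j≡i (part lam x) 1ℤ) (ℤP.+-monoˡ-≤ 1ℤ y≤) ,
                λ y+1≤μ → proj₂ b∈ (ℤP.≤-trans (ℤP.<⇒≤ (i<i+1 y)) y+1≤μ)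
        y≡y+1 : y ≡ y + 1ℤ
        y≡y+1 = ∼-same-row (injective _ _ b∈ next∈ (ℕP.≤-antisym
                  (rows x y (y + 1ℤ) (i<i+1 y) b∈ next∈)
                  (subst (T (x , y + 1ℤ) ℕ.≤_) (sym Tb≡max) (proj₂ (bounds _ next∈)))))

    gap-pos : 0ℤ ℤ.< gap lam x
    gap-pos with 0ℤ ℤ.<? gap lam x
    ... | yes 0<gap = 0<gap
    ... | no ¬0<gap = ⊥-elim (ℕP.<⇒≱ (columns x (x + 1ℤ) y (i<i+1 x) b∈ below∈) (subst (T (x + 1ℤ , y) ℕ.≤_) (sym Tb≡max) (proj₂ (bounds _ below∈))))
      where
      below∈ : InSkew lam mu (x + 1ℤ , y)
      below∈ = ℤP.≤-trans (ℤP.≤-reflexive at-row-end) (ℤP.i-j≤0⇒i≤j (ℤP.≮⇒≥ ¬0<gap)) ,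
               λ y≤μ → proj₂ b∈ (ℤP.≤-trans y≤μ (decreasing mu x))

    class-outside-mu : ∀ z → res x ≡ res z → part mu z ℤ.≤ part lam z - 1ℤ
    class-outside-mu z x≡z = 0<i-j⇒j≤i-1 {part lam z} {part mu z} (subst (0ℤ ℤ.<_) (sym (part-difference-res lam mu x z x≡z))
                               (j<i⇒0<i-j {part lam x} {part mu x} (subst (part mu x ℤ.<_) at-row-end (ℤP.≰⇒> (proj₂ b∈)))))

  module Recursion (lam mu : CylPart k n) (mu⊆lam : mu ⊆ lam) (lam≉mu : ¬ lam ≋ mu) where

    max-pos : ∀ T (t : IsSYT lam mu T) → 1 ℕ.≤ SYT.max lam mu T t
    max-pos T t with skew-nonempty lam mu mu⊆lam lam≉mu
    ... | b , b∈ = ℕP.≤-trans (proj₁ (SYT.bounds lam mu T t b b∈)) (proj₂ (SYT.bounds lam mu T t b b∈))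

    module Top (T : Tableau) (t : IsSYT lam mu T) where
      box : Σ Point λ b → InSkew lam mu b × T b ≡ SYT.max lam mu T t
      box = SYT.surjective lam mu T t (SYT.max lam mu T t) (max-pos T t) ℕP.≤-refl

      row col : ℤ
      row = proj₁ (proj₁ box)
      col = proj₂ (proj₁ box)

      ∈skew : InSkew lam mu (row , col)
      ∈skew = proj₁ (proj₂ box)

      is-max : T (row , col) ≡ SYT.max lam mu T t
      is-max = proj₂ (proj₂ box)

      open TopBox lam mu T t ∈skew is-max public

    class : ∀ T → IsSYT lam mu T → Fin k
    class T t = rfin (Top.row T t)

    class-res : ∀ T (t : IsSYT lam mu T) → res (Top.row T t) ≡ toℕ (class T t)
    class-res T t = sym (toℕ-rfin (Top.row T t))

    class-resp : ∀ T T′ (t : IsSYT lam mu T) (t′ : IsSYT lam mu T′) → SameTableau lam mu T T′ → class T t ≡ class T′ t′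
    class-resp T T′ t t′ T≈T′ = rfin-res (Top.row T t) (Top.row T′ t′) (∼⇒res {x} {y} {x′} {y′} top∼top′)
      where
      x = Top.row T t
      y = Top.col T t
      x′ = Top.row T′ t′
      y′ = Top.col T′ t′
      top∼top′ : (x , y) ∼ (x′ , y′)
      top∼top′ = SYT.injective lam mu T t (x , y) (x′ , y′) (Top.∈skew T t) (Top.∈skew T′ t′)
        (trans (Top.is-max T t) (trans (SYT-max-unique lam mu T T′ t t′ T≈T′) (trans (sym (Top.is-max T′ t′)) (sym (T≈T′ (x′ , y′) (Top.∈skew T′ t′))))))

    module _ (T : Tableau) (t : IsSYT lam mu T) {r} (class≡r : class T t ≡ r) where

      private
        top-res : res (Top.row T t) ≡ res (ρ r)
        top-res = trans (class-res T t) (trans (cong toℕ class≡r) (sym (res-ρ r)))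

      class-Removable : Removable lam r
      class-Removable = subst (0ℤ ℤ.<_) (gap-res lam (Top.row T t) (ρ r) top-res) (Top.gap-pos T t)

      class-⊆ : ∀ q → mu ⊆ rem lam r q
      class-⊆ q z = by-cases (χ-cases (res z ℕ.≟ toℕ r))
        where
        by-cases : (res z ≡ toℕ r × δ r z ≡ 1ℤ) ⊎ δ r z ≡ 0ℤ → part mu z ℤ.≤ part lam z - δ r z
        by-cases (inj₂ δ≡0)          = subst (λ d → part mu z ℤ.≤ part lam z - d) (sym δ≡0)
                                             (subst (part mu z ℤ.≤_) (sym (ℤP.+-identityʳ (part lam z))) (mu⊆lam z))
        by-cases (inj₁ (res≡r , δ≡1)) = subst (λ d → part mu z ℤ.≤ part lam z - d) (sym δ≡1)
                                             (Top.class-outside-mu T t z (trans top-res (trans (res-ρ r) (sym res≡r))))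

      top-∼corner : ∀ q → Corner.corner lam r q ∼ (Top.row T t , Top.col T t)
      top-∼corner q = subst (λ y → Corner.corner lam r q ∼ (Top.row T t , y)) {part lam (Top.row T t)} {Top.col T t} (sym (Top.at-row-end T t))
                            (Corner.corner-∼ lam r q (Top.row T t) (trans top-res (res-ρ r)))

      module Restriction (q : Removable lam r) where
        open Corner lam r q

        max′ : ℕ
        max′ = ℕ.pred (SYT.max lam mu T t)

        max≡ : SYT.max lam mu T t ≡ suc max′
        max≡ = sym (ℕP.suc-pred (SYT.max lam mu T t) {{ℕ.>-nonZero (max-pos T t)}})

        private
          top : Point
          top = Top.row T t , Top.col T t

          inc : ∀ {b} → InSkew nu mu b → InSkew lam mu b
          inc {b} = InSkew-mono {nu} {lam} {mu} {b} (rem-⊆ lam r q)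

          ∼corner⇒max : ∀ b → InSkew lam mu b → corner ∼ b → T b ≡ SYT.max lam mu T t
          ∼corner⇒max b b∈ corner∼b = trans (sym (SYT.box-invariant lam mu T t {top} {b} (Top.∈skew T t) top∼b)) (Top.is-max T t)
            where
            top∼b : top ∼ b
            top∼b = ∼-trans {top} {corner} {b} (∼-sym {corner} {top} (top-∼corner q)) corner∼b

          bounds : ∀ b → InSkew nu mu b → (1 ℕ.≤ T b) × (T b ℕ.≤ max′)
          bounds b b∈ = proj₁ (SYT.bounds lam mu T t b (inc b∈)) ,
            ℕP.≤-pred (ℕP.≤∧≢⇒< (subst (T b ℕ.≤_) max≡ (proj₂ (SYT.bounds lam mu T t b (inc b∈)))) Tb≢max)
            where
            Tb≢max : T b ≢ suc max′
            Tb≢max Tb≡ = ∼corner⇒∉nu {b} (∼-trans {corner} {top} {b} (top-∼corner q) top∼b) (proj₁ b∈)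
              where
              top∼b : top ∼ b
              top∼b = SYT.injective lam mu T t top b (Top.∈skew T t) (inc b∈) (trans (Top.is-max T t) (trans max≡ (sym Tb≡)))

          surjective : ∀ j → 1 ℕ.≤ j → j ℕ.≤ max′ → Σ Point λ b → InSkew nu mu b × T b ≡ j
          surjective j 1≤j j≤max′ = in-nu (SYT.surjective lam mu T t j 1≤j (subst (j ℕ.≤_) (sym max≡) (ℕP.m≤n⇒m≤1+n j≤max′)))
            where
            in-nu : (Σ Point λ b → InSkew lam mu b × T b ≡ j) → Σ Point λ b → InSkew nu mu b × T b ≡ j
            in-nu (b , b∈ , Tb≡j) = by-cases (proj₂ b ℤ.≤? part nu (proj₁ b))
              where
              by-cases : Dec (InPart nu b) → Σ Point λ b → InSkew nu mu b × T b ≡ j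
              by-cases (yes b∈nu) = b , (b∈nu , proj₂ b∈) , Tb≡j
              by-cases (no b∉nu)  = ⊥-elim (ℕP.<-irrefl refl (ℕP.≤-trans (s≤s j≤max′) (ℕP.≤-reflexive
                                       (trans (sym max≡) (trans (sym (∼corner⇒max b b∈ corner∼b)) Tb≡j)))))
                where
                corner∼b : corner ∼ b
                corner∼b = lam∖nu⇒∼corner {proj₁ b} {proj₂ b} (proj₁ b∈) b∉nu

        restricted : IsSYT nu mu T
        restricted = (λ x y b∈ → SYT.shift-invariant lam mu T t x y (inc b∈))
                   , (λ x y y′ y<y′ b∈ b′∈ → SYT.rows lam mu T t x y y′ y<y′ (inc b∈) (inc b′∈))
                   , (λ x x′ y x<x′ b∈ b′∈ → SYT.columns lam mu T t x x′ y x<x′ (inc b∈) (inc b′∈))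
                   , max′ , bounds
                   , (λ b b′ b∈ b′∈ → SYT.injective lam mu T t b b′ (inc b∈) (inc b′∈))
                   , surjective

        outside-nu : ∀ b → InSkew lam mu b → ¬ InPart nu b → T b ≡ suc max′
        outside-nu b b∈ b∉nu = trans (∼corner⇒max b b∈ (lam∖nu⇒∼corner {proj₁ b} {proj₂ b} (proj₁ b∈) b∉nu)) max≡

    module Extension {r} (q : Removable lam r) (mu⊆nu : mu ⊆ rem lam r q) {T′} (t′ : IsSYT (rem lam r q) mu T′) where
      open Corner lam r q

      max′ : ℕ
      max′ = SYT.max nu mu T′ t′

      ∈nu? : ∀ b → Dec (InPart nu b)
      ∈nu? (x , y) = y ℤ.≤? part nu x

      extend : ∀ b → Dec (InPart nu b) → ℕ
      extend b (yes _) = T′ b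
      extend b (no _)  = suc max′

      extended : Tableau
      extended b = extend b (∈nu? b)

      extend-∈ : ∀ b (d : Dec (InPart nu b)) → InPart nu b → extend b d ≡ T′ b
      extend-∈ b (yes _)   _    = refl
      extend-∈ b (no b∉nu) b∈nu = ⊥-elim (b∉nu b∈nu)

      extend-∉ : ∀ b (d : Dec (InPart nu b)) → ¬ InPart nu b → extend b d ≡ suc max′
      extend-∉ b (yes b∈nu) b∉nu = ⊥-elim (b∉nu b∈nu)
      extend-∉ b (no _)     _    = refl

      extended-∈ : ∀ b → InPart nu b → extended b ≡ T′ b
      extended-∈ b = extend-∈ b (∈nu? b)

      extended-∉ : ∀ b → ¬ InPart nu b → extended b ≡ suc max′
      extended-∉ b = extend-∉ b (∈nu? b)

      private
        bound′ : ∀ b → InPart nu b → InSkew lam mu b → T′ b ℕ.≤ max′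
        bound′ b b∈nu b∈ = proj₂ (SYT.bounds nu mu T′ t′ b (b∈nu , proj₂ b∈))

        shift-invariant : ∀ x y → InSkew lam mu (x , y) → extended (x , y) ≡ extended (x - K , y + w)
        shift-invariant x y b∈ = cases (∈nu? (x , y))
          where
          b′ = (x - K , y + w)
          cases : (d : Dec (InPart nu (x , y))) → extend (x , y) d ≡ extended b′
          cases (yes b∈nu) = trans (SYT.shift-invariant nu mu T′ t′ x y (b∈nu , proj₂ b∈))
                                   (sym (extended-∈ b′ (InPart-∼ nu {x , y} {b′} b∈nu (∼-next x y))))
          cases (no b∉nu)  = sym (extended-∉ b′ (λ b′∈nu → b∉nu (InPart-∼ nu {b′} {x , y} b′∈nu (∼-sym {x , y} {b′} (∼-next x y)))))

        rows : ∀ x y y′ → y ℤ.< y′ → InSkew lam mu (x , y) → InSkew lam mu (x , y′) → extended (x , y) ℕ.≤ extended (x , y′)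
        rows x y y′ y<y′ b∈ b′∈ = cases (∈nu? (x , y)) (∈nu? (x , y′))
          where
          cases : (d : Dec (InPart nu (x , y))) (d′ : Dec (InPart nu (x , y′))) → extend (x , y) d ℕ.≤ extend (x , y′) d′
          cases (yes b∈nu) (yes b′∈nu) = SYT.rows nu mu T′ t′ x y y′ y<y′ (b∈nu , proj₂ b∈) (b′∈nu , proj₂ b′∈)
          cases (yes b∈nu) (no _)      = ℕP.m≤n⇒m≤1+n (bound′ (x , y) b∈nu b∈)
          cases (no b∉nu)  (yes b′∈nu) = ⊥-elim (b∉nu (ℤP.≤-trans (ℤP.<⇒≤ y<y′) b′∈nu))
          cases (no _)     (no _)      = ℕP.≤-refl

        columns : ∀ x x′ y → x ℤ.< x′ → InSkew lam mu (x , y) → InSkew lam mu (x′ , y) → extended (x , y) ℕ.< extended (x′ , y)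
        columns x x′ y x<x′ b∈ b′∈ = cases (∈nu? (x , y)) (∈nu? (x′ , y))
          where
          -- A box of λ/ν ends its row and the row below is shorter, so no box of λ lies under it.
          outside-twice : ¬ InPart nu (x , y) → ⊥
          outside-twice b∉nu = ℤP.<⇒≱ (i<i+1 (part lam (x + 1ℤ))) (begin
            part lam (x + 1ℤ) + 1ℤ  ≤⟨ 0<i-j⇒j+1≤i {part lam x} gap-pos ⟩
            part lam x              ≡⟨ sym (proj₁ (∼corner⇒ corner∼b)) ⟩
            y                       ≤⟨ proj₁ b′∈ ⟩
            part lam x′             ≤⟨ part-antitone lam (subst (ℤ._≤ x′) (ℤP.+-comm 1ℤ x) (ℤP.i<j⇒suc[i]≤j x<x′)) ⟩
            part lam (x + 1ℤ)       ∎)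
            where
            open ℤP.≤-Reasoning
            corner∼b : corner ∼ (x , y)
            corner∼b = lam∖nu⇒∼corner {x} {y} (proj₁ b∈) b∉nu
            gap-pos : 0ℤ ℤ.< gap lam x
            gap-pos = subst (0ℤ ℤ.<_) (gap-res lam (ρ r) x (trans (res-ρ r) (sym (proj₂ (∼corner⇒ corner∼b))))) q
          cases : (d : Dec (InPart nu (x , y))) (d′ : Dec (InPart nu (x′ , y))) → extend (x , y) d ℕ.< extend (x′ , y) d′
          cases (yes b∈nu) (yes b′∈nu) = SYT.columns nu mu T′ t′ x x′ y x<x′ (b∈nu , proj₂ b∈) (b′∈nu , proj₂ b′∈)
          cases (yes b∈nu) (no _)      = s≤s (bound′ (x , y) b∈nu b∈)
          cases (no b∉nu)  (yes b′∈nu) = ⊥-elim (b∉nu (ℤP.≤-trans b′∈nu (part-antitone nu (ℤP.<⇒≤ x<x′))))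
          cases (no b∉nu)  (no _)      = ⊥-elim (outside-twice b∉nu)

        bounds : ∀ b → InSkew lam mu b → (1 ℕ.≤ extended b) × (extended b ℕ.≤ suc max′)
        bounds b b∈ = cases (∈nu? b)
          where
          cases : (d : Dec (InPart nu b)) → (1 ℕ.≤ extend b d) × (extend b d ℕ.≤ suc max′)
          cases (yes b∈nu) = proj₁ (SYT.bounds nu mu T′ t′ b (b∈nu , proj₂ b∈)) , ℕP.m≤n⇒m≤1+n (bound′ b b∈nu b∈)
          cases (no _)     = s≤s z≤n , ℕP.≤-refl

        injective : ∀ b b′ → InSkew lam mu b → InSkew lam mu b′ → extended b ≡ extended b′ → b ∼ b′
        injective b b′ b∈ b′∈ = cases (∈nu? b) (∈nu? b′)
          where
          cases : (d : Dec (InPart nu b)) (d′ : Dec (InPart nu b′)) → extend b d ≡ extend b′ d′ → b ∼ b′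
          cases (yes b∈nu) (yes b′∈nu) eq = SYT.injective nu mu T′ t′ b b′ (b∈nu , proj₂ b∈) (b′∈nu , proj₂ b′∈) eq
          cases (yes b∈nu) (no _)      eq = ⊥-elim (ℕP.<-irrefl refl (ℕP.≤-trans (s≤s (bound′ b b∈nu b∈)) (ℕP.≤-reflexive (sym eq))))
          cases (no _)     (yes b′∈nu) eq = ⊥-elim (ℕP.<-irrefl refl (ℕP.≤-trans (s≤s (bound′ b′ b′∈nu b′∈)) (ℕP.≤-reflexive eq)))
          cases (no b∉nu)  (no b′∉nu)  _  = ∼-trans {b} {corner} {b′} (∼-sym {corner} {b} (lam∖nu⇒∼corner {proj₁ b} {proj₂ b} (proj₁ b∈) b∉nu))
                                                     (lam∖nu⇒∼corner {proj₁ b′} {proj₂ b′} (proj₁ b′∈) b′∉nu)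

        surjective : ∀ j → 1 ℕ.≤ j → j ℕ.≤ suc max′ → Σ Point λ b → InSkew lam mu b × extended b ≡ j
        surjective j 1≤j j≤ = cases (j ℕ.≤? max′)
          where
          cases : Dec (j ℕ.≤ max′) → Σ Point λ b → InSkew lam mu b × extended b ≡ j
          cases (yes j≤max′) =
            let b , (b∈nu , b∉mu) , T′b≡j = SYT.surjective nu mu T′ t′ j 1≤j j≤max′
            in b , (InPart-mono {nu} {lam} {b} (rem-⊆ lam r q) b∈nu , b∉mu) , trans (extended-∈ b b∈nu) T′b≡j
          cases (no j≰max′) =
            corner , (corner∈lam , λ corner∈mu → corner∉nu (InPart-mono {mu} {nu} {corner} mu⊆nu corner∈mu)) ,
            trans (extended-∉ corner corner∉nu) (ℕP.≤-antisym (ℕP.≰⇒> j≰max′) j≤)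

      extended-SYT : IsSYT lam mu extended
      extended-SYT = shift-invariant , rows , columns , suc max′ , bounds , injective , surjective

      extended-class : (e : IsSYT lam mu extended) → class extended e ≡ r
      extended-class e = cases (∈nu? top)
        where
        top = Top.row extended e , Top.col extended e
        cases : Dec (InPart nu top) → class extended e ≡ r
        cases (yes top∈nu) = ⊥-elim (ℕP.<-irrefl refl (ℕP.≤-trans (s≤s (bound′ top top∈nu (Top.∈skew extended e)))
                                                                (ℕP.≤-reflexive (sym T′top≡))))
          where
          T′top≡ : T′ top ≡ suc max′
          T′top≡ = trans (sym (extended-∈ top top∈nu))
                         (trans (Top.is-max extended e) (SYT-max-unique lam mu extended extended e extended-SYT (λ _ _ → refl)))
        cases (no top∉nu)  = FP.toℕ-injective (trans (sym (class-res extended e))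
          (proj₂ (∼corner⇒ {proj₁ top} {proj₂ top} (lam∖nu⇒∼corner {proj₁ top} {proj₂ top} (proj₁ (Top.∈skew extended e)) top∉nu))))

    module Fibres (f : CylPart k n → CylPart k n → ℕ) (f-counts : ∀ l m → m ⊆ l → NumSYT l m (f l m)) where

      private
        Fibre : Fin k → Set
        Fibre = FibreEnum (SameTableau lam mu) (IsSYT lam mu) class

        empty-fibre : ∀ r → (∀ T t → class T t ≢ r) → Fibre r
        empty-fibre r none = record
          { size = 0 ; el = λ () ; el-in = λ () ; el-cls = λ () ; el-inj = λ ()
          ; el-surj = λ T t class≡r → ⊥-elim (none T t class≡r) }

        full-fibre : ∀ r (q : Removable lam r) → mu ⊆ rem lam r q → Fibre r
        full-fibre r q mu⊆nu = record
          { size = f nu mu ; el = λ j → X.extended j ; el-in = λ j → X.extended-SYT j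
          ; el-cls = λ j e → X.extended-class j e ; el-inj = el-inj ; el-surj = el-surj }
          where
          open Corner lam r q using (nu)
          open IsEnum (proj₂ (f-counts nu mu mu⊆nu))
          E = proj₁ (f-counts nu mu mu⊆nu)
          module X (j : Fin (f nu mu)) = Extension q mu⊆nu (enum-in j)
          inc : ∀ {b} → InSkew nu mu b → InSkew lam mu b
          inc {b} = InSkew-mono {nu} {lam} {mu} {b} (rem-⊆ lam r q)
          el-inj : ∀ j j′ → SameTableau lam mu (X.extended j) (X.extended j′) → j ≡ j′
          el-inj j j′ eq = enum-inj j j′ λ b b∈ →
            trans (sym (X.extended-∈ j b (proj₁ b∈))) (trans (eq b (inc b∈)) (X.extended-∈ j′ b (proj₁ b∈)))
          el-surj : ∀ T (t : IsSYT lam mu T) → class T t ≡ r → Σ (Fin (f nu mu)) λ j → SameTableau lam mu (X.extended j) T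
          el-surj T t class≡r = j , agree
            where
            module R = Restriction T t class≡r q
            j = proj₁ (enum-surj T R.restricted)
            Ej≈T = proj₂ (enum-surj T R.restricted)
            agree : SameTableau lam mu (X.extended j) T
            agree b b∈ = cases (X.∈nu? j b)
              where
              cases : Dec (InPart nu b) → X.extended j b ≡ T b
              cases (yes b∈nu) = trans (X.extended-∈ j b b∈nu) (Ej≈T b (b∈nu , proj₂ b∈))
              cases (no b∉nu)  = trans (X.extended-∉ j b b∉nu)
                                       (trans (cong suc (SYT-max-unique nu mu (E j) T (enum-in j) R.restricted Ej≈T)) (sym (R.outside-nu b b∈ b∉nu)))

        fibre-given : ∀ r q → Dec (mu ⊆ rem lam r q) → Fibre r
        fibre-given r q (yes mu⊆nu) = full-fibre r q mu⊆nu
        fibre-given r q (no mu⊈nu)  = empty-fibre r (λ T t class≡r → mu⊈nu (class-⊆ T t class≡r q))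

        fibre-if : ∀ r → Dec (Removable lam r) → Fibre r
        fibre-if r (yes q) = fibre-given r q (mu ⊆? rem lam r q)
        fibre-if r (no ¬q) = empty-fibre r (λ T t class≡r → ¬q (class-Removable T t class≡r))

        fibre : ∀ r → Fibre r
        fibre r = fibre-if r (Removable? lam r)

        fibre-given-size : ∀ r q (d : Dec (mu ⊆ rem lam r q)) → FibreEnum.size (fibre-given r q d) ≡ given d (λ _ → f (rem lam r q) mu)
        fibre-given-size r q (yes _) = refl
        fibre-given-size r q (no _)  = refl

        fibre-if-size : ∀ r (d : Dec (Removable lam r)) →
                        FibreEnum.size (fibre-if r d) ≡ given d (λ q → given (mu ⊆? rem lam r q) (λ _ → f (rem lam r q) mu))
        fibre-if-size r (yes q) = fibre-given-size r q (mu ⊆? rem lam r q)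
        fibre-if-size r (no _)  = refl

      f-recursion : f lam mu ≡ sum (λ r → given (Removable? lam r) λ q → given (mu ⊆? rem lam r q) λ _ → f (rem lam r q) mu)
      f-recursion = trans (enum-size-unique (λ eq b b∈ → sym (eq b b∈)) (λ eq eq′ b b∈ → trans (eq b b∈) (eq′ b b∈))
                                            (proj₂ (f-counts lam mu mu⊆lam)) (proj₂ (HasCard-fibres class class-resp fibre)))
                          (sum-cong-≗ (λ r → fibre-if-size r (Removable? lam r)))

  -- Counting tableaux by paths

  sum-paths-enumeration : ∀ d m a {cnt} (e : Fin cnt → CylPart k n) → (∀ i i′ → e i ≋ e i′ → i ≡ i′) →
                          ∀ h → Invariant h → (∀ c → Reach d m a c → h c ≢ 0 → Σ (Fin cnt) λ i → e i ≋ c) →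
                          sum (λ i → paths d m a (e i) ℕ.* h (e i)) ≡ steps d m h a
  sum-paths-enumeration d m a {cnt} e e-inj h inv e-surj = begin
    sum (λ i → paths d m a (e i) ℕ.* h (e i))              ≡⟨ sum-cong-≗ (λ i → steps-*ʳ d m (at (e i)) (h (e i)) a) ⟩
    sum (λ i → steps d m (λ c → at (e i) c ℕ.* h (e i)) a) ≡⟨ sym (steps-sum d m (λ i c → at (e i) c ℕ.* h (e i)) a) ⟩
    steps d m (λ c → sum (λ i → at (e i) c ℕ.* h (e i))) a ≡⟨ steps-cong-reach d m a counted-once ⟩
    steps d m h a                                          ∎
    where
    open ≡-Reasoning
    term : ∀ c i → at (e i) c ℕ.* h (e i) ≡ given (c ≋? e i) (λ _ → h c)
    term c i with c ≋? e i
    ... | yes c≋ei = trans (ℕP.+-identityʳ (h (e i))) (inv (e i) c (≋-sym {c} {e i} c≋ei))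
    ... | no _     = refl
    counted-once : ∀ c → Reach d m a c → sum (λ i → at (e i) c ℕ.* h (e i)) ≡ h c
    counted-once c reach with h c ℕ.≟ 0
    ... | yes hc≡0 = trans (sum-≡0 (λ i → trans (term c i) (given-≡0 (c ≋? e i) _ (λ _ → hc≡0)))) (sym hc≡0)
    ... | no hc≢0 with e-surj c reach hc≢0
    ...   | i₀ , ei₀≋c = trans (sum-single _ i₀ off) (trans (term c i₀) (given-const (c ≋? e i₀) (≋-sym {e i₀} {c} ei₀≋c)))
      where
      off : ∀ i → i ≢ i₀ → at (e i) c ℕ.* h (e i) ≡ 0
      off i i≢i₀ = trans (term c i) (given-no (c ≋? e i) _ λ c≋ei →
        i≢i₀ (e-inj i i₀ (≋-trans {e i} {c} {e i₀} (≋-sym {c} {e i} c≋ei) (≋-sym {e i₀} {c} ei₀≋c))))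

  module CountingByPaths (f : CylPart k n → CylPart k n → ℕ) (f-counts : ∀ l m → m ⊆ l → NumSYT l m (f l m)) where

    open Recursion.Fibres using (f-recursion)

    f-≋ : ∀ lam mu → mu ⊆ lam → lam ≋ mu → f lam mu ≡ 1
    f-≋ lam mu mu⊆lam lam≋mu = enum-size-unique (λ eq b b∈ → sym (eq b b∈)) (λ eq eq′ b b∈ → trans (eq b b∈) (eq′ b b∈))
                                                (proj₂ (f-counts lam mu mu⊆lam)) single
      where
      no-box : ∀ b → ¬ InSkew lam mu b
      no-box (x , y) (y≤λ , y≰μ) = y≰μ (subst (y ℤ.≤_) (lam≋mu x) y≤λ)
      empty : IsSYT lam mu (λ _ → 0)
      empty = (λ x y b∈ → ⊥-elim (no-box _ b∈)) , (λ x y y′ _ b∈ _ → ⊥-elim (no-box _ b∈))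
            , (λ x x′ y _ b∈ _ → ⊥-elim (no-box _ b∈)) , 0 , (λ b b∈ → ⊥-elim (no-box b b∈))
            , (λ b b′ b∈ _ _ → ⊥-elim (no-box b b∈)) , (λ j 1≤j j≤0 → ⊥-elim (ℕP.<⇒≱ 1≤j j≤0))
      single : IsEnum (SameTableau lam mu) (IsSYT lam mu) 1 (λ _ _ → 0)
      single = record { enum-in = λ _ → empty ; enum-inj = λ { F.zero F.zero _ → refl }
                      ; enum-surj = λ T _ → F.zero , λ b b∈ → ⊥-elim (no-box b b∈) }

    -- A standard tableau is a chain of box removals, so f counts descending paths.
    f≡paths : ∀ d lam mu → mu ⊆ lam → size lam ≡ size mu + + d → f lam mu ≡ paths down d lam mu
    f≡paths zero lam mu mu⊆lam size≡ = by-cases (lam ≋? mu)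
      where
      no-removal : ∀ r q → ¬ mu ⊆ rem lam r q
      no-removal r q mu⊆nu = ℤP.<⇒≱ (i<i+1 (size (rem lam r q)))
        (subst (ℤ._≤ size (rem lam r q)) (sym (trans (sym (size-rem lam r q)) (trans size≡ (ℤP.+-identityʳ (size mu)))))
               (size-mono {mu} {rem lam r q} mu⊆nu))
      by-cases : Dec (lam ≋ mu) → f lam mu ≡ paths down zero lam mu
      by-cases (yes lam≋mu) = trans (f-≋ lam mu mu⊆lam lam≋mu) (sym (given-const (lam ≋? mu) lam≋mu))
      by-cases (no lam≉mu)  = begin
        f lam mu                                                                  ≡⟨ f-recursion lam mu mu⊆lam lam≉mu f f-counts ⟩
        sum (λ r → given (Removable? lam r) λ q → given (mu ⊆? rem lam r q) λ _ → f (rem lam r q) mu)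
          ≡⟨ sum-≡0 (λ r → given-≡0 (Removable? lam r) _ λ q → given-no (mu ⊆? rem lam r q) (λ _ → f (rem lam r q) mu) (no-removal r q)) ⟩
        0                                                                         ≡⟨ sym (given-no (lam ≋? mu) (λ _ → 1) lam≉mu) ⟩
        paths down zero lam mu                                                    ∎
        where open ≡-Reasoning
    f≡paths (suc d) lam mu mu⊆lam size≡ = by-cases (lam ≋? mu)
      where
      next-size : ∀ r q → size (rem lam r q) ≡ size mu + + d
      next-size r q = ∙-cancelʳ 1ℤ (size (rem lam r q)) (size mu + + d)
        (trans (sym (size-rem lam r q)) (trans size≡ (move-one (size mu) (+ d))))
        where
        move-one : ∀ s D → s + (1ℤ + D) ≡ s + D + 1ℤ
        move-one = solve-∀
      term : ∀ r q → (dec : Dec (mu ⊆ rem lam r q)) → given dec (λ _ → f (rem lam r q) mu) ≡ paths down d (rem lam r q) mu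
      term r q (yes mu⊆nu) = f≡paths d (rem lam r q) mu mu⊆nu (next-size r q)
      term r q (no mu⊈nu)  = sym (paths-down-vanish-⊆ d (rem lam r q) mu mu⊈nu)
      by-cases : Dec (lam ≋ mu) → f lam mu ≡ paths down (suc d) lam mu
      by-cases (yes lam≋mu) = ⊥-elim (+suc≢0 (∙-cancelˡ (size mu) (+ suc d) 0ℤ
        (trans (sym size≡) (trans (size-≋ {lam} {mu} lam≋mu) (sym (ℤP.+-identityʳ (size mu)))))))
        where
        +suc≢0 : + suc d ≢ 0ℤ
        +suc≢0 ()
      by-cases (no lam≉mu)  = trans (f-recursion lam mu mu⊆lam lam≉mu f f-counts)
        (sum-cong-≗ λ r → given-cong (Removable? lam r) λ q → term r q (mu ⊆? rem lam r q))

    f≡paths-NumBoxes : ∀ lam mu m → mu ⊆ lam → NumBoxes lam mu m → f lam mu ≡ paths down m lam mu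
    f≡paths-NumBoxes lam mu m mu⊆lam boxes = by-cases (d ℕ.≟ m)
      where
      d = proj₁ (≤⇒≡+ℕ (size-mono {mu} {lam} mu⊆lam))
      size≡ : size lam ≡ size mu + + d
      size≡ = proj₂ (≤⇒≡+ℕ (size-mono {mu} {lam} mu⊆lam))
      by-cases : Dec (d ≡ m) → f lam mu ≡ paths down m lam mu
      by-cases (yes refl) = f≡paths d lam mu mu⊆lam size≡
      by-cases (no d≢m)   = trans (f≡paths d lam mu mu⊆lam size≡) (trans paths-d≡0 (sym paths-m≡0))
        where
        paths-d≡0 : paths down d lam mu ≡ 0
        paths-d≡0 = decidable-stable (paths down d lam mu ℕ.≟ 0)
                      (λ ≢0 → d≢m (NumBoxes-unique {lam} {mu} (paths-down≢0⇒NumBoxes d lam mu ≢0) boxes))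
        paths-m≡0 : paths down m lam mu ≡ 0
        paths-m≡0 = paths-down-vanish-size m lam mu (λ eq → d≢m (ℤP.+-injective (∙-cancelˡ (size mu) (+ d) (+ m) (trans (sym size≡) eq))))

  module Theorem (f : CylPart k n → CylPart k n → ℕ) (f-counts : ∀ l m → m ⊆ l → NumSYT l m (f l m))
              (α β : CylPart k n) (m : ℕ)
              {cM} {eM : Fin cM → CylPart k n} (EM : IsEnum _≋_ (InM α β m) cM eM)
              {cΛ} {eΛ : Fin cΛ → CylPart k n} (EΛ : IsEnum _≋_ (InΛ α β m) cΛ eΛ) where

    open CountingByPaths f f-counts
    private
      module M = IsEnum EM
      module Λ = IsEnum EΛ

    module _ (j : ℕ) (size≡ : size α + + j ≡ size β + + m) where

      left-term : ∀ i → f α (eM i) ℕ.* f β (eM i) ≡ paths down m α (eM i) ℕ.* paths up j (eM i) β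
      left-term i = trans (cong (ℕ._* f β μ) (f≡paths-NumBoxes α μ m μ⊆α boxes)) (*-congˡ-≢0 (paths down m α μ) f≡)
        where
        μ = eM i
        μ⊆α = proj₁ (M.enum-in i)
        μ⊆β = proj₁ (proj₂ (M.enum-in i))
        boxes = proj₂ (proj₂ (M.enum-in i))
        d = proj₁ (≤⇒≡+ℕ (size-mono {μ} {β} μ⊆β))
        size-β≡ = proj₂ (≤⇒≡+ℕ (size-mono {μ} {β} μ⊆β))
        f≡ : paths down m α μ ≢ 0 → f β μ ≡ paths up j μ β
        f≡ ≢0 = trans (f≡paths d β μ μ⊆β size-β≡) (trans (paths-reverse d β μ)
                  (cong (λ z → paths up z μ β) (ℤP.+-injective d≡j)))
          where
          d≡j : + d ≡ + j
          d≡j = offset-unique {size μ} {size β} {size α} {+ m} {+ d} {+ j} (paths-down≢0⇒size m α μ ≢0) size-β≡ size≡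

      right-term : ∀ l → f (eΛ l) α ℕ.* f (eΛ l) β ≡ paths up j α (eΛ l) ℕ.* paths down m (eΛ l) β
      right-term l = trans (cong (f λ′ α ℕ.*_) (f≡paths-NumBoxes λ′ β m β⊆λ boxes)) (*-congʳ-≢0 (paths down m λ′ β) f≡)
        where
        λ′ = eΛ l
        α⊆λ = proj₁ (Λ.enum-in l)
        β⊆λ = proj₁ (proj₂ (Λ.enum-in l))
        boxes = proj₂ (proj₂ (Λ.enum-in l))
        d = proj₁ (≤⇒≡+ℕ (size-mono {α} {λ′} α⊆λ))
        size-λ≡ = proj₂ (≤⇒≡+ℕ (size-mono {α} {λ′} α⊆λ))
        f≡ : paths down m λ′ β ≢ 0 → f λ′ α ≡ paths up j α λ′
        f≡ ≢0 = trans (f≡paths d λ′ α α⊆λ size-λ≡) (trans (paths-reverse d λ′ α)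
                  (cong (λ z → paths up z α λ′) (ℤP.+-injective
                    (∙-cancelˡ (size α) (+ d) (+ j) (trans (sym size-λ≡) (trans (paths-down≢0⇒size m λ′ β ≢0) (sym size≡)))))))

      M-complete : ∀ c → Reach down m α c → paths up j c β ≢ 0 → Σ (Fin cM) λ i → eM i ≋ c
      M-complete c reach ≢0 = M.enum-surj c (Reach-down-⊆ m α c reach , c⊆β , Reach-down-NumBoxes m α c reach)
        where
        c⊆β = paths-down≢0⇒⊆ j β c (λ ≡0 → ≢0 (trans (sym (paths-reverse j β c)) ≡0))

      Λ-complete : ∀ c → Reach up j α c → paths down m c β ≢ 0 → Σ (Fin cΛ) λ l → eΛ l ≋ c
      Λ-complete c reach ≢0 = Λ.enum-surj c (Reach-up-⊇ j α c reach , paths-down≢0⇒⊆ m c β ≢0 , paths-down≢0⇒NumBoxes m c β ≢0)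

      -- Both sides equal ⟨D^m U^j α, β⟩ = ⟨U^j D^m α, β⟩.
      sums-agree-at : sum (λ i → f α (eM i) ℕ.* f β (eM i)) ≡ sum (λ l → f (eΛ l) α ℕ.* f (eΛ l) β)
      sums-agree-at = begin
        sum (λ i → f α (eM i) ℕ.* f β (eM i))                          ≡⟨ sum-cong-≗ left-term ⟩
        sum (λ i → paths down m α (eM i) ℕ.* paths up j (eM i) β)      ≡⟨ sum-paths-enumeration down m α eM M.enum-inj
                                                                            (λ c → paths up j c β) (steps-invariant up j (at-invariant β)) M-complete ⟩
        steps down m (steps up j (at β)) α                             ≡⟨ steps-down-up m j (at-invariant β) α ⟩
        steps up j (steps down m (at β)) α                             ≡⟨ sum-paths-enumeration up j α eΛ Λ.enum-inj
                                                                            (λ c → paths down m c β) (steps-invariant down m (at-invariant β)) Λ-complete ⟨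
        sum (λ l → paths up j α (eΛ l) ℕ.* paths down m (eΛ l) β)      ≡⟨ sum-cong-≗ right-term ⟨
        sum (λ l → f (eΛ l) α ℕ.* f (eΛ l) β)                          ∎
        where open ≡-Reasoning

    module _ (too-small : size β + + m ℤ.< size α) where

      left-vanishes : ∀ i → f α (eM i) ℕ.* f β (eM i) ≡ 0
      left-vanishes i = cong (ℕ._* f β μ) (trans (f≡paths-NumBoxes α μ m μ⊆α boxes) (paths-down-vanish-size m α μ size≢))
        where
        μ = eM i
        μ⊆α = proj₁ (M.enum-in i)
        μ⊆β = proj₁ (proj₂ (M.enum-in i))
        boxes = proj₂ (proj₂ (M.enum-in i))
        size≢ : size α ≢ size μ + + m
        size≢ eq = ℤP.<⇒≱ too-small (subst (ℤ._≤ size β + + m) (sym eq) (ℤP.+-monoˡ-≤ (+ m) (size-mono {μ} {β} μ⊆β)))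

      right-vanishes : ∀ l → f (eΛ l) α ℕ.* f (eΛ l) β ≡ 0
      right-vanishes l = trans (cong (f λ′ α ℕ.*_) (trans (f≡paths-NumBoxes λ′ β m β⊆λ boxes) (paths-down-vanish-size m λ′ β size≢)))
                               (ℕP.*-zeroʳ (f λ′ α))
        where
        λ′ = eΛ l
        α⊆λ = proj₁ (Λ.enum-in l)
        β⊆λ = proj₁ (proj₂ (Λ.enum-in l))
        boxes = proj₂ (proj₂ (Λ.enum-in l))
        size≢ : size λ′ ≢ size β + + m
        size≢ eq = ℤP.<⇒≱ too-small (subst (size α ℤ.≤_) eq (size-mono {α} {λ′} α⊆λ))

    sums-agree : sum (λ i → f α (eM i) ℕ.* f β (eM i)) ≡ sum (λ l → f (eΛ l) α ℕ.* f (eΛ l) β)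
    sums-agree with size α ℤ.≤? size β + + m
    ... | yes α≤ = sums-agree-at (proj₁ (≤⇒≡+ℕ α≤)) (sym (proj₂ (≤⇒≡+ℕ α≤)))
    ... | no α≰  = trans (sum-≡0 (left-vanishes (ℤP.≰⇒> α≰))) (sym (sum-≡0 (right-vanishes (ℤP.≰⇒> α≰))))

open import Data.Nat using (zero; suc; _<_; _*_)
open import Data.Fin using (Fin)
open import Relation.Binary.PropositionalEquality using (_≡_; trans; sym)

mainTheorem2 : (k n : ℕ) → 0 < k → k < n → (α β : CylPart k n) (m : ℕ)
    → (f : CylPart k n → CylPart k n → ℕ)
    → (∀ lam mu → mu ⊆ lam → NumSYT lam mu (f lam mu))
    → (cM : ℕ) (eM : Fin cM → CylPart k n) → IsEnum _≋_ (InM α β m) cM eM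
    → (cΛ : ℕ) (eΛ : Fin cΛ → CylPart k n) → IsEnum _≋_ (InΛ α β m) cΛ eΛ
    → ∑ cM (λ i → f α (eM i) * f β (eM i))
      ≡ ∑ cΛ (λ j → f (eΛ j) α * f (eΛ j) β)
mainTheorem2 zero    n () _ α β m f f-counts cM eM EM cΛ eΛ EΛ
mainTheorem2 (suc k′) n _ _ α β m f f-counts cM eM EM cΛ eΛ EΛ =
  trans (FiniteSums.∑≡sum cM (λ i → f α (eM i) * f β (eM i)))
        (trans (Cylinder.Theorem.sums-agree k′ n f f-counts α β m EM EΛ)
               (sym (FiniteSums.∑≡sum cΛ (λ j → f (eΛ j) α * f (eΛ j) β))))
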